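{- Let $G=(V,E)$ be a finite loopless multigraph whose edges operate independently with probabilities $p(e)\in[0,1]$, let $K\subseteq V$ with $|K|\ge2$, and let $(G^1,G^2,X)$ be a $K$-splitting of $(G,K)$. Then \[ R(G,K)=\left[\mathbf{Z}^T\mathbf{p}(G^1)\right]_0^T\,\mathbf{\Lambda}_0\,\left[\mathbf{Z}^T\mathbf{p}(G^2)\right]_0. \]
   Context: Labelled set partitions: for a finite set $Y$ and a symbol $l\notin Y$, a labelled set partition of $Y$ is $\pi=\{B_1\cup L_1,\dots,B_k\cup L_k\}$ with $\{B_1,\dots,B_k\}$ a set partition of $Y$ and $L_i\in\{\emptyset,\{l\}\}$ (labelled block iff $L_i=\{l\}$). $\Pi_l(Y)$ is the set of these, ordered by $\sigma\le\pi$ iff every block of $\sigma$ (including $l$ if present) is contained in a block of $\pi$; $\mu$ is the Möbius function of $\Pi_l(X)$. $m(\pi)=1$ if $\pi$ has exactly one labelled block, else $0$. For $\pi\in\Pi_l(W)$, $Y\subseteq W$, $\pi\sqcap Y\in\Pi_l(Y)$ has blocks $(B\cap Y)\cup L$ for blocks $B\cup L$ of $\pi$ with $B\cap Y\ne\emptyset$. Graphs may have parallel edges but no loops. A spanning subgraph $H'=(W,F')$ of $H=(W,F)$ has probability $\mathrm{Pr}(H')=\prod_{e\in F'}p(e)\prod_{e\in F\setminus F'}(1-p(e))$. For $K'\subseteq W$: $M(H,K')=1$ if all of $K'$ lies in one connected component, else $0$; $R(H,K')=\sum_{H'}M(H',K')\mathrm{Pr}(H')$ over spanning subgraphs; $\{(H,K')\}\in\Pi_l(W)$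 has as blocks the vertex sets of connected components, labelled iff meeting $K'$. For $Y\subseteq W$, $H_Y$ identifies all of $Y$ into one vertex $Y$, deleting edges with both endpoints in $Y$ and keeping other edges. $K$-splitting: $G^i=(V^i,E^i)$ subgraphs of $G$ with $E^1\cup E^2=E$, $E^1\cap E^2=\emptyset$, $V^1\cup V^2=V$, $V^1\cap V^2=X$, $K^i:=K\cap V^i\ne\emptyset$. $K^i_X=(K^i\setminus X)\cup\{X\}$. For a spanning subgraph $H^i$ of $G^i$, $D(H^i,\pi)=1$ if $\{(H^i,K^i)\}\sqcap X=\pi$, else $0$; $P(G^i,\pi)=\sum_{H^i}D(H^i,\pi)M(H^i_X,K^i_X)\mathrm{Pr}(H^i)$. $\pi_X$ is the partition of $X$ into singletons $\{x\}$, labelled iff $x\in K$; $\Pi_l(X,\pi_X)=\{\pi\in\Pi_l(X):\pi\ge\pi_X,\ \pi\text{ has a labelled block}\}$. For $\pi\in\Pi_l(X,\pi_X)$, $\lambda(\pi)=\sum_{\sigma\in\Pi_l(X,\pi_X),\sigma\ge\pi}\mu(\pi,\sigma)m(\sigma)$; $\Pi_l(X,\pi_X)_0=\{\pi:\lambda(\pi)\ne0\}$. With a fixed ordering of $\Pi_l(X,\pi_X)$: $\mathbf{p}(G^i)=(P(G^i,\pi))_\pi$; $\mathbf{Z}=(z_{\pi,\sigma})$ with $z_{\pi,\sigma}=1$ if $\pi\le\sigma$, else $0$; $\mathbf{\Lambda}$ diagonal with entries $\lambda(\pi)$. For a vector $v$ or matrix $A$ indexed by $\Pi_l(X,\pi_X)$,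 $[v]_0$ and $A_0$ denote deletion of all entries/rows/columns whose index is not in $\Pi_l(X,\pi_X)_0$. -}

module Defs where

open import Level using (Level)
open import Data.Bool using (Bool; true; false; _∧_; _∨_; not; if_then_else_; T)
open import Data.Nat using (ℕ; zero; suc; _<ᵇ_; _≡ᵇ_)
open import Data.Fin using (Fin; zero; suc; toℕ; _≟_)
open import Data.Integer as ℤ using (ℤ; +_; -[1+_])
open import Data.List using (List; []; _∷_; map; concatMap; length; lookup)
open import Data.Product using (_×_; _,_; proj₁; proj₂; Σ; ∃)
open import Data.Sum using (_⊎_)
open import Relation.Nullary using (¬_)
open import Relation.Nullary.Decidable using (⌊_⌋)
open import Relation.Binary.PropositionalEquality using (_≢_)
open import Algebra.Bundles using (CommutativeRing)

VSet : ℕ → Set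
VSet k = Fin k → Bool

_⇒ᵇ_ : Bool → Bool → Bool
a ⇒ᵇ b = not a ∨ b

_==ᵇ_ : Bool → Bool → Bool
true  ==ᵇ b = b
false ==ᵇ b = not b

_=F=_ : {k : ℕ} → Fin k → Fin k → Bool
x =F= y = ⌊ x ≟ y ⌋

anyF : (k : ℕ) → (Fin k → Bool) → Bool
anyF zero    f = false
anyF (suc k) f = f zero ∨ anyF k (λ i → f (suc i))

allF : (k : ℕ) → (Fin k → Bool) → Bool
allF zero    f = true
allF (suc k) f = f zero ∧ allF k (λ i → f (suc i))

countF : (k : ℕ) → (Fin k → Bool) → ℕ
countF zero    f = zero
countF (suc k) f = (if f zero then suc (countF k (λ i → f (suc i)))
                              else countF k (λ i → f (suc i)))

filterB : {A : Set} → (A → Bool) → List A → List A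
filterB p []       = []
filterB p (x ∷ xs) = if p x then x ∷ filterB p xs else filterB p xs

consF : {A : Set} {k : ℕ} → A → (Fin k → A) → Fin (suc k) → A
consF a f zero    = a
consF a f (suc i) = f i

allFuns : {A : Set} → List A → (k : ℕ) → List (Fin k → A)
allFuns xs zero    = (λ ()) ∷ []
allFuns xs (suc k) = concatMap (λ a → map (consF a) (allFuns xs k)) xs

bools : List Bool
bools = true ∷ false ∷ []

allSubsets : (k : ℕ) → List (VSet k)
allSubsets k = allFuns bools k

record Multigraph : Set where
  field
    n        : ℕ
    m        : ℕ
    ends     : Fin m → Fin n × Fin n
    loopless : ∀ e → proj₁ (ends e) ≢ proj₂ (ends e)

-- A labelled partition {B₁ ∪ L₁, …} is encoded canonically by the
-- equivalence relation "same block" on Y (false outside Y) together with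
-- the predicate "lies in a labelled block" (false outside Y, constant on
-- blocks).  This is a bijective encoding.

record LPart (k : ℕ) : Set where
  constructor lp
  field
    rel : Fin k → Fin k → Bool
    lab : Fin k → Bool
open LPart public

isLPart : {k : ℕ} → VSet k → LPart k → Bool
isLPart {k} Y π =
  allF k λ x → allF k λ y →
       (rel π x y ⇒ᵇ (Y x ∧ Y y))
     ∧ (Y x ⇒ᵇ rel π x x)
     ∧ (rel π x y ⇒ᵇ rel π y x)
     ∧ (rel π x y ⇒ᵇ (lab π x ==ᵇ lab π y))
     ∧ (lab π x ⇒ᵇ Y x)
     ∧ (allF k λ z → (rel π x y ∧ rel π y z) ⇒ᵇ rel π x z)

-- Π_l(Y), as a duplicate-free list
ΠL : {k : ℕ} → VSet k → List (LPart k)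
ΠL {k} Y = filterB (isLPart Y)
  (concatMap (λ r → map (lp r) (allSubsets k)) (allFuns (allSubsets k) k))

-- σ ≤ π : every block of σ (with l if present) lies in a block of π
_≤L_ : {k : ℕ} → LPart k → LPart k → Bool
_≤L_ {k} σ π = (allF k λ x → allF k λ y → rel σ x y ⇒ᵇ rel π x y)
             ∧ (allF k λ x → lab σ x ⇒ᵇ lab π x)

_=L=_ : {k : ℕ} → LPart k → LPart k → Bool
σ =L= π = (σ ≤L π) ∧ (π ≤L σ)

_<L_ : {k : ℕ} → LPart k → LPart k → Bool
σ <L π = (σ ≤L π) ∧ not (σ =L= π)

-- number of labelled blocks (counted via their least element)
numLabelledBlocks : {k : ℕ} → LPart k → ℕ
numLabelledBlocks {k} π =
  countF k λ x → lab π x ∧ (allF k λ y → (toℕ y <ᵇ toℕ x) ⇒ᵇ not (rel π x y))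

hasLabelledBlock : {k : ℕ} → LPart k → Bool
hasLabelledBlock {k} π = anyF k (lab π)

mL : {k : ℕ} → LPart k → ℤ
mL π = if numLabelledBlocks π ≡ᵇ 1 then + 1 else + 0

_⊓_ : {k : ℕ} → LPart k → VSet k → LPart k
π ⊓ Y = lp (λ u v → Y u ∧ Y v ∧ rel π u v) (λ u → Y u ∧ lab π u)

sumℤ : {A : Set} → (A → ℤ) → List A → ℤ
sumℤ f []       = + 0
sumℤ f (x ∷ xs) = f x ℤ.+ sumℤ f xs

-- Möbius function of the poset P (given as a list), by the standard
-- recursion μ(π,π)=1, μ(π,σ) = -Σ_{π≤τ<σ} μ(π,τ) for π<σ, 0 otherwise;
-- the first argument is recursion fuel (sufficient when > |P|).
mobiusFuel : {k : ℕ} → List (LPart k) → ℕ → LPart k → LPart k → ℤ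
mobiusFuel P zero    π σ = + 0
mobiusFuel P (suc f) π σ =
  if π =L= σ then + 1
  else if π ≤L σ
    then ℤ.- sumℤ (λ τ → mobiusFuel P f π τ) (filterB (λ τ → (π ≤L τ) ∧ (τ <L σ)) P)
    else + 0

μL : {k : ℕ} → VSet k → LPart k → LPart k → ℤ
μL X π σ = mobiusFuel (ΠL X) (suc (length (ΠL X))) π σ

-- Graph notions for a graph with vertex type Fin k, edges Fin e given by
-- `ends`, vertex set W and edge set F (edges of F have ends in W).

reach : {k e : ℕ} → (Fin e → Fin k × Fin k) → VSet e → ℕ → Fin k → Fin k → Bool
reach ends F zero    u v = u =F= v
reach {k} {e} ends F (suc t) u v = (u =F= v) ∨
  (anyF e λ d → F d ∧ (  ((proj₁ (ends d) =F= u) ∧ reach ends F t (proj₂ (ends d)) v)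
                      ∨ ((proj₂ (ends d) =F= u) ∧ reach ends F t (proj₁ (ends d)) v)))

conn : {k e : ℕ} → (Fin e → Fin k × Fin k) → VSet e → Fin k → Fin k → Bool
conn {k} ends F u v = reach ends F k u v

Mconn : {k e : ℕ} → (Fin e → Fin k × Fin k) → VSet e → VSet k → Bool
Mconn {k} ends F K' = allF k λ u → allF k λ v → (K' u ∧ K' v) ⇒ᵇ conn ends F u v

compPart : {k e : ℕ} → (Fin e → Fin k × Fin k) → VSet e → VSet k → VSet k → LPart k
compPart {k} ends F W K' =
  lp (λ u v → W u ∧ W v ∧ conn ends F u v)
     (λ u → W u ∧ anyF k (λ w → K' w ∧ conn ends F u w))

-- H_Y: vertex zero of Fin (suc k) is the new vertex Y, suc v is old v.
contrV : {k : ℕ} → VSet k → Fin k → Fin (suc k)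
contrV Y v = if Y v then zero else suc v

contrEnds : {k e : ℕ} → VSet k → (Fin e → Fin k × Fin k) → Fin e → Fin (suc k) × Fin (suc k)
contrEnds Y ends d = contrV Y (proj₁ (ends d)) , contrV Y (proj₂ (ends d))

contrF : {k e : ℕ} → VSet k → (Fin e → Fin k × Fin k) → VSet e → VSet e
contrF Y ends F d = F d ∧ not (Y (proj₁ (ends d)) ∧ Y (proj₂ (ends d)))

contrSet : {k : ℕ} → VSet k → VSet k → VSet (suc k)
contrSet Y K' zero    = true
contrSet Y K' (suc v) = K' v ∧ not (Y v)

-- spanning subgraphs of (W,F): edge subsets F' ⊆ F
spanning : {e : ℕ} → VSet e → List (VSet e)
spanning {e} F = filterB (λ F' → allF e λ d → F' d ⇒ᵇ F d) (allSubsets e)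

_∩ᵛ_ : {k : ℕ} → VSet k → VSet k → VSet k
(A ∩ᵛ B) v = A v ∧ B v

record IsKSplitting (G : Multigraph) (K : VSet (Multigraph.n G))
                    (V1 V2 : VSet (Multigraph.n G)) (E1 E2 : VSet (Multigraph.m G)) : Set where
  open Multigraph G
  field
    sub1      : ∀ d → T (E1 d) → T (V1 (proj₁ (ends d))) × T (V1 (proj₂ (ends d)))
    sub2      : ∀ d → T (E2 d) → T (V2 (proj₁ (ends d))) × T (V2 (proj₂ (ends d)))
    edgeUnion : ∀ d → T (E1 d) ⊎ T (E2 d)
    edgeDisj  : ∀ d → ¬ (T (E1 d) × T (E2 d))
    vertUnion : ∀ v → T (V1 v) ⊎ T (V2 v)
    K1≠∅      : ∃ λ v → T (K v ∧ V1 v)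
    K2≠∅      : ∃ λ v → T (K v ∧ V2 v)

module WithRing {c ℓ : Level} (Rg : CommutativeRing c ℓ) where
  open CommutativeRing Rg using (Carrier; _+_; _*_; -_; 0#; 1#)

  fromℕ : ℕ → Carrier
  fromℕ zero    = 0#
  fromℕ (suc k) = 1# + fromℕ k

  fromℤ : ℤ → Carrier
  fromℤ (+ k)    = fromℕ k
  fromℤ -[1+ k ] = - fromℕ (suc k)

  ind : Bool → Carrier
  ind b = if b then 1# else 0#

  sumL : {A : Set} → (A → Carrier) → List A → Carrier
  sumL f []       = 0#
  sumL f (x ∷ xs) = f x + sumL f xs

  sumFin : (k : ℕ) → (Fin k → Carrier) → Carrier
  sumFin zero    f = 0#
  sumFin (suc k) f = f zero + sumFin k (λ i → f (suc i))

  prodFin : (k : ℕ) → (Fin k → Carrier) → Carrier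
  prodFin zero    f = 1#
  prodFin (suc k) f = f zero * prodFin k (λ i → f (suc i))

  Pr : {e : ℕ} → (Fin e → Carrier) → VSet e → VSet e → Carrier
  Pr {e} p F F' = prodFin e λ d →
    if F d then (if F' d then p d else 1# + - p d) else 1#

  module _ (G : Multigraph) (p : Fin (Multigraph.m G) → Carrier) where
    open Multigraph G

    allE : VSet m
    allE _ = true

    allV : VSet n
    allV _ = true

    Rel : VSet n → Carrier
    Rel K = sumL (λ F' → ind (Mconn ends F' K) * Pr p allE F') (spanning allE)

    module Split (K V1 V2 : VSet n) (E1 E2 : VSet m) where

      X : VSet n
      X = V1 ∩ᵛ V2

      πX : LPart n
      πX = lp (λ x y → X x ∧ X y ∧ (x =F= y)) (λ x → X x ∧ K x)

      ΠX : List (LPart n)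
      ΠX = filterB (λ π → (πX ≤L π) ∧ hasLabelledBlock π) (ΠL X)

      λL : LPart n → ℤ
      λL π = sumℤ (λ σ → μL X π σ ℤ.* mL σ) (filterB (λ σ → π ≤L σ) ΠX)

      Pfun : VSet n → VSet m → LPart n → Carrier
      Pfun Vi Ei π = sumL (λ F' →
          ind ((compPart ends F' Vi (K ∩ᵛ Vi) ⊓ X) =L= π)
        * ind (Mconn (contrEnds X ends) (contrF X ends F') (contrSet X (K ∩ᵛ Vi)))
        * Pr p Ei F') (spanning Ei)

      N : ℕ
      N = length ΠX

      idx : Fin N → LPart n
      idx = lookup ΠX

      pvec : VSet n → VSet m → Fin N → Carrier
      pvec Vi Ei j = Pfun Vi Ei (idx j)

      Z : Fin N → Fin N → Carrier
      Z i j = ind (idx i ≤L idx j)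

      Λ : Fin N → Fin N → Carrier
      Λ i j = if i =F= j then fromℤ (λL (idx i)) else 0#

      transpose : {a b : ℕ} → (Fin a → Fin b → Carrier) → Fin b → Fin a → Carrier
      transpose A j i = A i j

      matVec : {a b : ℕ} → (Fin a → Fin b → Carrier) → (Fin b → Carrier) → Fin a → Carrier
      matVec {a} {b} A v i = sumFin b λ j → A i j * v j

      dot : {a : ℕ} → (Fin a → Carrier) → (Fin a → Carrier) → Carrier
      dot {a} u v = sumFin a λ i → u i * v i

      allPos : (k : ℕ) → List (Fin k)
      allPos zero    = []
      allPos (suc k) = zero ∷ map suc (allPos k)

      nz : ℤ → Bool
      nz (+ zero) = false
      nz _        = true

      pos0 : List (Fin N)
      pos0 = filterB (λ j → nz (λL (idx j))) (allPos N)

      N0 : ℕ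
      N0 = length pos0

      sel : Fin N0 → Fin N
      sel = lookup pos0

      vec0 : (Fin N → Carrier) → Fin N0 → Carrier
      vec0 v i = v (sel i)

      mat0 : (Fin N → Fin N → Carrier) → Fin N0 → Fin N0 → Carrier
      mat0 A i j = A (sel i) (sel j)

      rhs : Carrier
      rhs = dot (vec0 (matVec (transpose Z) (pvec V1 E1)))
                (matVec (mat0 Λ) (vec0 (matVec (transpose Z) (pvec V2 E2))))

-- Both sides are rewritten as the double sum over spanning subgraphs
-- H₁ = (V¹, F₁) of G¹ and H₂ = (V², F₂) of G² of
--   M(H₁_X, K¹_X) M(H₂_X, K²_X) m(ρ) Pr(H₁) Pr(H₂),   ρ = {(H₁ ∪ H₂, K)} ⊓ X.
-- Left: the spanning subgraphs of G are the unions H₁ ∪ H₂ (EdgeSubsets),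
-- Pr factorises, and M(H₁ ∪ H₂, K) = M(H₁_X) M(H₂_X) m(ρ) (Splitting).
-- Right: the π-entry of Zᵀ p(Gⁱ) is Σ_{Hᵢ} M(Hᵢ_X) Pr(Hᵢ) [πᵢ ≤ π], where
-- πᵢ = {(Hᵢ, Kⁱ)} ⊓ X; entries with λ = 0 do not contribute, and
-- Σ_π [π₁ ≤ π][π₂ ≤ π] λ(π) = Σ_{π ≥ π₁ ∨ π₂} λ(π) = m(ρ), since ρ = π₁ ∨ π₂
-- (Splitting) and by Möbius inversion in Π_l(X, π_X) (Mobius).
module Submission where

open import Level using (Level)
open import Algebra.Bundles using (CommutativeRing)
open import Defs
open import Data.Nat using (ℕ; _≤_)
open import Data.Fin using (Fin)

module BoolReflection where

  open import Defs
  open import Data.Bool using (Bool; true; false; _∧_; _∨_; not; T)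
  open import Data.Bool.Properties using (T-∧; T-∨; T?)
  open import Data.Unit using (tt)
  open import Data.Nat using (zero; suc; _≤_; _<_; z≤n; s≤s)
  open import Data.Nat.Properties using (m≤n⇒m≤1+n)
  open import Data.Fin using (Fin; zero; suc; toℕ; _≟_)
  open import Data.Fin.Properties using (0≢1+n; suc-injective)
  open import Data.Product using (_×_; _,_; proj₁; proj₂; ∃)
  open import Data.Sum using (_⊎_; inj₁; inj₂)
  open import Data.Empty using (⊥-elim)
  open import Function.Bundles using (Equivalence)
  open import Relation.Nullary using (¬_; yes; no)
  open import Relation.Binary.PropositionalEquality using (_≡_; refl; sym; cong; subst)

  ∧⁻ : ∀ {a b} → T (a ∧ b) → T a × T b
  ∧⁻ {a} {b} = Equivalence.to (T-∧ {a} {b})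

  ∧⁺ : ∀ {a b} → T a → T b → T (a ∧ b)
  ∧⁺ {a} {b} p q = Equivalence.from (T-∧ {a} {b}) (p , q)

  ∧⁻ˡ : ∀ {a b} → T (a ∧ b) → T a
  ∧⁻ˡ {a} p = proj₁ (∧⁻ {a} p)

  ∧⁻ʳ : ∀ {a b} → T (a ∧ b) → T b
  ∧⁻ʳ {a} p = proj₂ (∧⁻ {a} p)

  ∨⁻ : ∀ {a b} → T (a ∨ b) → T a ⊎ T b
  ∨⁻ {a} {b} = Equivalence.to (T-∨ {a} {b})

  ∨⁺ˡ : ∀ {a b} → T a → T (a ∨ b)
  ∨⁺ˡ {a} {b} p = Equivalence.from (T-∨ {a} {b}) (inj₁ p)

  ∨⁺ʳ : ∀ {a b} → T b → T (a ∨ b)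
  ∨⁺ʳ {a} {b} p = Equivalence.from (T-∨ {a} {b}) (inj₂ p)

  ⇒⁻ : ∀ {a b} → T (a ⇒ᵇ b) → T a → T b
  ⇒⁻ {true} p _ = p

  ⇒⁺ : ∀ {a b} → (T a → T b) → T (a ⇒ᵇ b)
  ⇒⁺ {true}  f = f tt
  ⇒⁺ {false} _ = tt

  not⁻ : ∀ {a} → T (not a) → ¬ T a
  not⁻ {true} ()

  not⁺ : ∀ {a} → ¬ T a → T (not a)
  not⁺ {true}  f = f tt
  not⁺ {false} _ = tt

  ==⁻ : ∀ {a b} → T (a ==ᵇ b) → a ≡ b
  ==⁻ {true}  {true}  _ = refl
  ==⁻ {false} {false} _ = refl

  ==⁺ : ∀ {a b} → a ≡ b → T (a ==ᵇ b)
  ==⁺ {true}  refl = tt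
  ==⁺ {false} refl = tt

  =F⁻ : ∀ {k} {x y : Fin k} → T (x =F= y) → x ≡ y
  =F⁻ {x = x} {y} p with x ≟ y
  ... | yes e = e

  =F⁺ : ∀ {k} {x y : Fin k} → x ≡ y → T (x =F= y)
  =F⁺ {x = x} {y} e with x ≟ y
  ... | yes _ = tt
  ... | no ne = ne e

  T-ext : ∀ {a b} → (T a → T b) → (T b → T a) → a ≡ b
  T-ext {true}  {true}  _ _ = refl
  T-ext {true}  {false} f _ = ⊥-elim (f tt)
  T-ext {false} {true}  _ g = ⊥-elim (g tt)
  T-ext {false} {false} _ _ = refl

  ¬T⇒≡false : ∀ {a} → ¬ T a → a ≡ false
  ¬T⇒≡false {true}  f = ⊥-elim (f tt)
  ¬T⇒≡false {false} _ = refl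

  T⇒≡true : ∀ {a} → T a → a ≡ true
  T⇒≡true {true} _ = refl

  allF⁻ : ∀ k {f : Fin k → Bool} → T (allF k f) → ∀ i → T (f i)
  allF⁻ (suc k) p zero    = ∧⁻ˡ p
  allF⁻ (suc k) p (suc i) = allF⁻ k (∧⁻ʳ p) i

  allF⁺ : ∀ k {f : Fin k → Bool} → (∀ i → T (f i)) → T (allF k f)
  allF⁺ zero    g = tt
  allF⁺ (suc k) g = ∧⁺ (g zero) (allF⁺ k (λ i → g (suc i)))

  anyF⁻ : ∀ k {f : Fin k → Bool} → T (anyF k f) → ∃ λ i → T (f i)
  anyF⁻ (suc k) {f} p with ∨⁻ {f zero} p
  ... | inj₁ q = zero , q
  ... | inj₂ q with anyF⁻ k q
  ... | i , r = suc i , r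

  anyF⁺ : ∀ k {f : Fin k → Bool} i → T (f i) → T (anyF k f)
  anyF⁺ (suc k) zero q = ∨⁺ˡ q
  anyF⁺ (suc k) {f} (suc i) q = ∨⁺ʳ {f zero} (anyF⁺ k i q)

  allF-cong : ∀ k {f g : Fin k → Bool} → (∀ i → f i ≡ g i) → allF k f ≡ allF k g
  allF-cong zero    e = refl
  allF-cong (suc k) e rewrite e zero | allF-cong k (λ i → e (suc i)) = refl

  countF-cong : ∀ k {f g : Fin k → Bool} → (∀ i → f i ≡ g i) → countF k f ≡ countF k g
  countF-cong zero    e = refl
  countF-cong (suc k) e rewrite e zero | countF-cong k (λ i → e (suc i)) = refl

  countF-≤ : ∀ k (f : Fin k → Bool) → countF k f ≤ k
  countF-≤ zero    f = z≤n
  countF-≤ (suc k) f with f zero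
  ... | true  = s≤s (countF-≤ k _)
  ... | false = m≤n⇒m≤1+n (countF-≤ k _)

  countF-pos : ∀ k {f : Fin k → Bool} i → T (f i) → 1 ≤ countF k f
  countF-pos (suc k) {f} i p with f zero in eq
  ... | true = s≤s z≤n
  countF-pos (suc k) zero    p | false = ⊥-elim (subst T eq p)
  countF-pos (suc k) (suc i) p | false = countF-pos k i p

  countF-mono : ∀ k {f g : Fin k → Bool} → (∀ i → T (f i) → T (g i)) → countF k f ≤ countF k g
  countF-mono zero _ = z≤n
  countF-mono (suc k) {f} {g} h with f zero in ef | g zero in eg
  ... | true  | true  = s≤s (countF-mono k (λ i → h (suc i)))
  ... | true  | false = ⊥-elim (subst T eg (h zero (subst T (sym ef) tt)))
  ... | false | true  = m≤n⇒m≤1+n (countF-mono k (λ i → h (suc i)))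
  ... | false | false = countF-mono k (λ i → h (suc i))

  countF-strict : ∀ k {f g : Fin k → Bool} → (∀ i → T (f i) → T (g i))
                → ∀ j → T (g j) → ¬ T (f j) → countF k f < countF k g
  countF-strict (suc k) h zero gj nfj rewrite ¬T⇒≡false nfj | T⇒≡true gj =
    s≤s (countF-mono k (λ i → h (suc i)))
  countF-strict (suc k) {f} {g} h (suc j) gj nfj with f zero in ef | g zero in eg
  ... | true  | true  = s≤s (countF-strict k (λ i → h (suc i)) j gj nfj)
  ... | true  | false = ⊥-elim (subst T eg (h zero (subst T (sym ef) tt)))
  ... | false | true  = m≤n⇒m≤1+n (countF-strict k (λ i → h (suc i)) j gj nfj)
  ... | false | false = countF-strict k (λ i → h (suc i)) j gj nfj

  countF-zero : ∀ k {f : Fin k → Bool} → (∀ i → ¬ T (f i)) → countF k f ≡ 0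
  countF-zero zero    _ = refl
  countF-zero (suc k) {f} n with f zero in eq
  ... | true  = ⊥-elim (n zero (subst T (sym eq) tt))
  ... | false = countF-zero k (λ i → n (suc i))

  countF≡1 : ∀ k {Q : Fin k → Bool} a → T (Q a) → (∀ x y → T (Q x) → T (Q y) → x ≡ y) → countF k Q ≡ 1
  countF≡1 (suc k) {Q} a qa u with Q zero in eq
  ... | true = cong suc (countF-zero k (λ i q → 0≢1+n (u zero (suc i) (subst T (sym eq) tt) q)))
  countF≡1 (suc k) zero    qa u | false = ⊥-elim (subst T eq qa)
  countF≡1 (suc k) (suc a) qa u | false = countF≡1 k a qa (λ x y qx qy → suc-injective (u (suc x) (suc y) qx qy))

  private
    only-one : ∀ {m} → suc m ≡ 1 → ¬ (1 ≤ m)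
    only-one refl ()

  countF≡1-unique : ∀ k {Q : Fin k → Bool} → countF k Q ≡ 1 → ∀ x y → T (Q x) → T (Q y) → x ≡ y
  countF≡1-unique (suc k) {Q} c x y qx qy with Q zero in eq
  countF≡1-unique (suc k) c zero    zero    qx qy | true  = refl
  countF≡1-unique (suc k) c zero    (suc y) qx qy | true  = ⊥-elim (only-one c (countF-pos k y qy))
  countF≡1-unique (suc k) c (suc x) y       qx qy | true  = ⊥-elim (only-one c (countF-pos k x qx))
  countF≡1-unique (suc k) c zero    y       qx qy | false = ⊥-elim (subst T eq qx)
  countF≡1-unique (suc k) c (suc x) zero    qx qy | false = ⊥-elim (subst T eq qy)
  countF≡1-unique (suc k) c (suc x) (suc y) qx qy | false = cong suc (countF≡1-unique k c x y qx qy)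

  least : ∀ k (f : Fin k → Bool) i → T (f i) → ∃ λ j → T (f j) × (∀ j' → toℕ j' < toℕ j → ¬ T (f j'))
  least (suc k) f i p with f zero in eq
  ... | true = zero , subst T (sym eq) tt , (λ j' ())
  least (suc k) f zero    p | false = ⊥-elim (subst T eq p)
  least (suc k) f (suc i) p | false with least k (λ x → f (suc x)) i p
  ... | j , fj , below = suc j , fj , minimal
    where minimal : ∀ j' → toℕ j' < suc (toℕ j) → ¬ T (f j')
          minimal zero     _         q = subst T eq q
          minimal (suc j') (s≤s lt)  q = below j' lt q

  ¬allF⇒∃¬ : ∀ k {f : Fin k → Bool} → ¬ T (allF k f) → ∃ λ i → ¬ T (f i)
  ¬allF⇒∃¬ zero    n = ⊥-elim (n tt)
  ¬allF⇒∃¬ (suc k) {f} n with T? (f zero)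
  ... | no q  = zero , q
  ... | yes q with T? (allF k (λ i → f (suc i)))
  ...   | yes r = ⊥-elim (n (∧⁺ q r))
  ...   | no r  = let (i , s) = ¬allF⇒∃¬ k r in suc i , s

module RingSums {c ℓ : Level} (Rg : CommutativeRing c ℓ) where

  open import Defs
  open BoolReflection
  open import Data.Bool using (true; false; _∧_; not; if_then_else_; T)
  open import Data.Unit using (tt)
  open import Data.Nat as ℕ using (ℕ; zero; suc)
  import Data.Nat.Properties as ℕP
  open import Data.Integer as ℤ using (ℤ; +_; -[1+_]; _⊖_)
  import Data.Integer.Properties as ℤP
  open import Data.Fin using (Fin; zero; suc)
  open import Data.Fin.Properties using (0≢1+n; suc-injective)
  open import Data.List using (List; []; _∷_; map; concatMap; length; lookup; _++_)
  open import Data.List.Membership.Propositional using (_∈_)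
  open import Data.List.Relation.Unary.Any using (here; there)
  open import Data.Empty using (⊥-elim)
  open import Relation.Nullary using (¬_)
  open import Relation.Binary.PropositionalEquality as P using (_≡_)
  open WithRing Rg public
  open CommutativeRing Rg hiding (zero)
  open import Relation.Binary.Reasoning.Setoid setoid
  open import Algebra.Solver.CommutativeMonoid *-commutativeMonoid using (solve; _⊜_; _⊕_)
  open import Algebra.Properties.Group +-group using (ε⁻¹≈ε)
  open import Algebra.Properties.AbelianGroup +-abelianGroup using (⁻¹-∙-comm)

  private
    variable
      A B : Set

  ≡⇒≈ : ∀ {x y} → x ≡ y → x ≈ y
  ≡⇒≈ P.refl = refl

  *-interchange : ∀ a b x y → (a * b) * (x * y) ≈ (a * x) * (b * y)
  *-interchange = solve 4 (λ a b x y → (a ⊕ b) ⊕ (x ⊕ y) ⊜ (a ⊕ x) ⊕ (b ⊕ y)) refl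

  *-swapˡ : ∀ a b x → a * (b * x) ≈ b * (a * x)
  *-swapˡ = solve 3 (λ a b x → a ⊕ (b ⊕ x) ⊜ b ⊕ (a ⊕ x)) refl

  ind-T : ∀ {a} → T a → ind a ≈ 1#
  ind-T {true} _ = refl

  ind-F : ∀ {a} → ¬ T a → ind a ≈ 0#
  ind-F {true}  f = ⊥-elim (f tt)
  ind-F {false} _ = refl

  ind-∧ : ∀ a b → ind (a ∧ b) ≈ ind a * ind b
  ind-∧ true  b = sym (*-identityˡ _)
  ind-∧ false b = sym (zeroˡ _)

  ind-≡ : ∀ {a b} → a ≡ b → ind a ≈ ind b
  ind-≡ P.refl = refl

  ind-T* : ∀ {a} x → T a → ind a * x ≈ x
  ind-T* x t = trans (*-congʳ (ind-T t)) (*-identityˡ x)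

  ind-F* : ∀ {a} x → ¬ T a → ind a * x ≈ 0#
  ind-F* x t = trans (*-congʳ (ind-F t)) (zeroˡ x)

  ind-∧* : ∀ a b x → ind a * (ind b * x) ≈ ind (a ∧ b) * x
  ind-∧* a b x = trans (sym (*-assoc _ _ _)) (*-congʳ (sym (ind-∧ a b)))

  zero-factorˡ : ∀ {a b} → a ≈ 0# → a * b ≈ 0#
  zero-factorˡ {b = b} e = trans (*-congʳ e) (zeroˡ b)

  zero-factorʳ : ∀ {a b} → b ≈ 0# → a * b ≈ 0#
  zero-factorʳ {a = a} e = trans (*-congˡ e) (zeroʳ a)

  if-true : ∀ {lA} {A : Set lA} {b} {x y : A} → T b → (if b then x else y) ≡ x
  if-true {b = true} _ = P.refl

  if-false : ∀ {lA} {A : Set lA} {b} {x y : A} → ¬ T b → (if b then x else y) ≡ y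
  if-false {b = true}  f = ⊥-elim (f tt)
  if-false {b = false} _ = P.refl

  sumL-cong : ∀ {f g : A → Carrier} xs → (∀ x → f x ≈ g x) → sumL f xs ≈ sumL g xs
  sumL-cong []       e = refl
  sumL-cong (x ∷ xs) e = +-cong (e x) (sumL-cong xs e)

  sumL-cong∈ : ∀ {f g : A → Carrier} xs → (∀ x → x ∈ xs → f x ≈ g x) → sumL f xs ≈ sumL g xs
  sumL-cong∈ []       e = refl
  sumL-cong∈ (x ∷ xs) e = +-cong (e x (here P.refl)) (sumL-cong∈ xs (λ y m → e y (there m)))

  sumL-0 : ∀ {f : A → Carrier} xs → (∀ x → f x ≈ 0#) → sumL f xs ≈ 0#
  sumL-0 []       e = refl
  sumL-0 (x ∷ xs) e = trans (+-cong (e x) (sumL-0 xs e)) (+-identityˡ 0#)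

  sumL-++ : ∀ (f : A → Carrier) xs ys → sumL f (xs ++ ys) ≈ sumL f xs + sumL f ys
  sumL-++ f []       ys = sym (+-identityˡ _)
  sumL-++ f (x ∷ xs) ys = trans (+-congˡ (sumL-++ f xs ys)) (sym (+-assoc _ _ _))

  sumL-map : ∀ (f : B → Carrier) (g : A → B) xs → sumL f (map g xs) ≈ sumL (λ x → f (g x)) xs
  sumL-map f g []       = refl
  sumL-map f g (x ∷ xs) = +-congˡ (sumL-map f g xs)

  sumL-concatMap : ∀ (f : B → Carrier) (g : A → List B) xs
                 → sumL f (concatMap g xs) ≈ sumL (λ x → sumL f (g x)) xs
  sumL-concatMap f g []       = refl
  sumL-concatMap f g (x ∷ xs) = trans (sumL-++ f (g x) (concatMap g xs)) (+-congˡ (sumL-concatMap f g xs))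

  sumL-filter : ∀ (f : A → Carrier) p xs → sumL f (filterB p xs) ≈ sumL (λ x → ind (p x) * f x) xs
  sumL-filter f p []       = refl
  sumL-filter f p (x ∷ xs) with p x
  ... | true  = +-cong (sym (*-identityˡ _)) (sumL-filter f p xs)
  ... | false = trans (sumL-filter f p xs) (trans (sym (+-identityˡ _)) (+-congʳ (sym (zeroˡ _))))

  sumL-+ : ∀ (f g : A → Carrier) xs → sumL (λ x → f x + g x) xs ≈ sumL f xs + sumL g xs
  sumL-+ f g []       = sym (+-identityˡ 0#)
  sumL-+ f g (x ∷ xs) = begin
    (f x + g x) + sumL (λ x → f x + g x) xs ≈⟨ +-congˡ (sumL-+ f g xs) ⟩
    (f x + g x) + (sumL f xs + sumL g xs)   ≈⟨ +-assoc _ _ _ ⟩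
    f x + (g x + (sumL f xs + sumL g xs))   ≈⟨ +-congˡ (sym (+-assoc _ _ _)) ⟩
    f x + ((g x + sumL f xs) + sumL g xs)   ≈⟨ +-congˡ (+-congʳ (+-comm _ _)) ⟩
    f x + ((sumL f xs + g x) + sumL g xs)   ≈⟨ +-congˡ (+-assoc _ _ _) ⟩
    f x + (sumL f xs + (g x + sumL g xs))   ≈⟨ sym (+-assoc _ _ _) ⟩
    (f x + sumL f xs) + (g x + sumL g xs)   ∎

  sumL-*ˡ : ∀ a (f : A → Carrier) xs → a * sumL f xs ≈ sumL (λ x → a * f x) xs
  sumL-*ˡ a f []       = zeroʳ a
  sumL-*ˡ a f (x ∷ xs) = trans (distribˡ a _ _) (+-congˡ (sumL-*ˡ a f xs))

  sumL-*ʳ : ∀ a (f : A → Carrier) xs → sumL f xs * a ≈ sumL (λ x → f x * a) xs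
  sumL-*ʳ a f xs = trans (*-comm _ a) (trans (sumL-*ˡ a f xs) (sumL-cong xs (λ x → *-comm a (f x))))

  sumL-swap : ∀ (f : A → B → Carrier) xs ys
            → sumL (λ x → sumL (λ y → f x y) ys) xs ≈ sumL (λ y → sumL (λ x → f x y) xs) ys
  sumL-swap f []       ys = sym (sumL-0 ys (λ _ → refl))
  sumL-swap f (x ∷ xs) ys =
    trans (+-congˡ (sumL-swap f xs ys)) (sym (sumL-+ (f x) (λ y → sumL (λ x → f x y) xs) ys))

  sumFin-cong : ∀ k {f g : Fin k → Carrier} → (∀ i → f i ≈ g i) → sumFin k f ≈ sumFin k g
  sumFin-cong zero    e = refl
  sumFin-cong (suc k) e = +-cong (e zero) (sumFin-cong k (λ i → e (suc i)))

  sumFin-lookup : ∀ (f : A → Carrier) xs → sumFin (length xs) (λ j → f (lookup xs j)) ≈ sumL f xs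
  sumFin-lookup f []       = refl
  sumFin-lookup f (x ∷ xs) = +-congˡ (sumFin-lookup f xs)

  prodFin-cong : ∀ k {f g : Fin k → Carrier} → (∀ i → f i ≈ g i) → prodFin k f ≈ prodFin k g
  prodFin-cong zero    e = refl
  prodFin-cong (suc k) e = *-cong (e zero) (prodFin-cong k (λ i → e (suc i)))

  prodFin-* : ∀ k (f g : Fin k → Carrier) → prodFin k (λ i → f i * g i) ≈ prodFin k f * prodFin k g
  prodFin-* zero    f g = sym (*-identityˡ 1#)
  prodFin-* (suc k) f g = trans (*-congˡ (prodFin-* k _ _)) (sym (*-interchange _ _ _ _))

  fromℕ-+ : ∀ m n → fromℕ (m ℕ.+ n) ≈ fromℕ m + fromℕ n
  fromℕ-+ zero    n = sym (+-identityˡ _)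
  fromℕ-+ (suc m) n = trans (+-congˡ (fromℕ-+ m n)) (sym (+-assoc _ _ _))

  cancel-1# : ∀ a b → (1# + a) + - (1# + b) ≈ a + - b
  cancel-1# a b = begin
    (1# + a) + - (1# + b)     ≈⟨ +-congˡ (sym (⁻¹-∙-comm 1# b)) ⟩
    (1# + a) + (- 1# + - b)   ≈⟨ +-assoc _ _ _ ⟩
    1# + (a + (- 1# + - b))   ≈⟨ +-congˡ (sym (+-assoc _ _ _)) ⟩
    1# + ((a + - 1#) + - b)   ≈⟨ +-congˡ (+-congʳ (+-comm a (- 1#))) ⟩
    1# + ((- 1# + a) + - b)   ≈⟨ +-congˡ (+-assoc _ _ _) ⟩
    1# + (- 1# + (a + - b))   ≈⟨ sym (+-assoc _ _ _) ⟩
    (1# + - 1#) + (a + - b)   ≈⟨ +-congʳ (-‿inverseʳ 1#) ⟩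
    0# + (a + - b)            ≈⟨ +-identityˡ _ ⟩
    a + - b                   ∎

  fromℤ-⊖ : ∀ m n → fromℤ (m ⊖ n) ≈ fromℕ m + - fromℕ n
  fromℤ-⊖ zero    zero    = trans (sym ε⁻¹≈ε) (sym (+-identityˡ _))
  fromℤ-⊖ zero    (suc n) = sym (+-identityˡ _)
  fromℤ-⊖ (suc m) zero    = sym (trans (+-congˡ ε⁻¹≈ε) (+-identityʳ _))
  fromℤ-⊖ (suc m) (suc n) = begin
    fromℤ (suc m ⊖ suc n)        ≡⟨ P.cong fromℤ (ℤP.[1+m]⊖[1+n]≡m⊖n m n) ⟩
    fromℤ (m ⊖ n)                ≈⟨ fromℤ-⊖ m n ⟩
    fromℕ m + - fromℕ n          ≈⟨ sym (cancel-1# (fromℕ m) (fromℕ n)) ⟩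
    fromℕ (suc m) + - fromℕ (suc n) ∎

  fromℤ-+ : ∀ a b → fromℤ (a ℤ.+ b) ≈ fromℤ a + fromℤ b
  fromℤ-+ -[1+ m ] -[1+ n ] = begin
    - fromℕ (suc (suc (m ℕ.+ n)))       ≡⟨ P.cong (λ z → - fromℕ (suc z)) (P.sym (ℕP.+-suc m n)) ⟩
    - fromℕ (suc m ℕ.+ suc n)           ≈⟨ -‿cong (fromℕ-+ (suc m) (suc n)) ⟩
    - (fromℕ (suc m) + fromℕ (suc n))   ≈⟨ sym (⁻¹-∙-comm _ _) ⟩
    - fromℕ (suc m) + - fromℕ (suc n)   ∎
  fromℤ-+ -[1+ m ] (+ n)    = trans (fromℤ-⊖ n (suc m)) (+-comm _ _)
  fromℤ-+ (+ m)    -[1+ n ] = fromℤ-⊖ m (suc n)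
  fromℤ-+ (+ m)    (+ n)    = fromℕ-+ m n

  fromℤ-sum : ∀ (f : A → ℤ) xs → fromℤ (sumℤ f xs) ≈ sumL (λ x → fromℤ (f x)) xs
  fromℤ-sum f []       = refl
  fromℤ-sum f (x ∷ xs) = trans (fromℤ-+ (f x) (sumℤ f xs)) (+-congˡ (fromℤ-sum f xs))

  fromℤ-ind : ∀ b z → fromℤ (if b then z else + 0) ≈ ind b * fromℤ z
  fromℤ-ind true  z = sym (*-identityˡ _)
  fromℤ-ind false z = sym (zeroˡ _)

  ind-split-top : ∀ a b c → (T c → T b) → ind (a ∧ b) ≈ ind (a ∧ (b ∧ not c)) + ind c * ind a
  ind-split-top false b     c     h = sym (trans (+-identityˡ _) (zeroʳ _))
  ind-split-top true  true  true  h = trans (sym (*-identityˡ 1#)) (sym (+-identityˡ _))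
  ind-split-top true  true  false h = sym (trans (+-congˡ (zeroˡ _)) (+-identityʳ _))
  ind-split-top true  false true  h = ⊥-elim (h tt)
  ind-split-top true  false false h = sym (trans (+-congˡ (zeroˡ _)) (+-identityʳ _))

  ind-split-bottom : ∀ a b c → (T c → T a) → ind (a ∧ b) ≈ ind c * ind b + ind ((a ∧ not c) ∧ b)
  ind-split-bottom false b true  h = ⊥-elim (h tt)
  ind-split-bottom false b false h = sym (trans (+-identityʳ _) (zeroˡ _))
  ind-split-bottom true  b true  h = sym (trans (+-identityʳ _) (*-identityˡ _))
  ind-split-bottom true  b false h = sym (trans (+-congʳ (zeroˡ _)) (+-identityˡ _))

  mL-one : ∀ {k} (π : LPart k) → numLabelledBlocks π ≡ 1 → fromℤ (mL π) ≈ 1#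
  mL-one π one = trans (≡⇒≈ (P.cong fromℤ (if-true {b = numLabelledBlocks π ℕ.≡ᵇ 1} (ℕP.≡⇒≡ᵇ _ 1 one))))
                       (+-identityʳ 1#)

  mL-other : ∀ {k} (π : LPart k) → ¬ (numLabelledBlocks π ≡ 1) → fromℤ (mL π) ≈ 0#
  mL-other π other = ≡⇒≈ (P.cong fromℤ (if-false {b = numLabelledBlocks π ℕ.≡ᵇ 1} (λ t → other (ℕP.≡ᵇ⇒≡ _ 1 t))))

  sumFin-δ : ∀ k (h : Fin k → Carrier) s → sumFin k (λ j → ind (s =F= j) * h j) ≈ h s
  sumFin-δ (suc k) h zero = trans (+-cong (ind-T* (h zero) (=F⁺ {x = zero {k}} P.refl))
                                          (sumFin-zero k (λ j → ind-F* (h (suc j)) (λ q → 0≢1+n (=F⁻ {x = zero} {y = suc j} q)))))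
                                  (+-identityʳ _)
    where
    sumFin-zero : ∀ k {f : Fin k → Carrier} → (∀ i → f i ≈ 0#) → sumFin k f ≈ 0#
    sumFin-zero zero    e = refl
    sumFin-zero (suc k) e = trans (+-cong (e zero) (sumFin-zero k (λ i → e (suc i)))) (+-identityˡ 0#)
  sumFin-δ (suc k) h (suc s) = trans (+-cong (ind-F* (h zero) (λ q → 0≢1+n (P.sym (=F⁻ {x = suc s} {y = zero} q))))
                                             (sumFin-cong k (λ j → *-congʳ (ind-≡ (suc-=F j)))))
                                     (trans (+-identityˡ _) (sumFin-δ k (λ j → h (suc j)) s))
    where
    suc-=F : ∀ j → (_=F=_ {suc k} (suc s) (suc j)) ≡ (s =F= j)
    suc-=F j = T-ext (λ q → =F⁺ (suc-injective (=F⁻ q))) (λ q → =F⁺ (P.cong suc (=F⁻ q)))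

module PartitionOrder where

  open import Defs
  open BoolReflection
  open import Data.Bool using (Bool; _∧_; not; if_then_else_; T)
  open import Data.Bool.Properties using (T?)
  open import Data.Nat using (ℕ; _<_; _<ᵇ_; _≡ᵇ_)
  open import Data.Nat.Properties using (<ᵇ⇒<; <⇒<ᵇ; <-cmp)
  open import Data.Fin using (Fin; toℕ)
  open import Data.Fin.Properties using (toℕ-injective)
  open import Data.Product using (_×_; _,_; ∃)
  open import Data.Empty using (⊥-elim)
  open import Relation.Binary.Definitions using (tri<; tri≈; tri>)
  open import Relation.Nullary using (¬_; Dec)
  open import Relation.Nullary.Decidable using (map′)
  open import Relation.Binary.PropositionalEquality using (_≡_; sym; trans; cong; cong₂; subst)

  module _ {k : ℕ} where

    record _⊑_ (σ π : LPart k) : Set where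
      constructor le
      field unle : T (σ ≤L π)
    open _⊑_ public

    record _≐_ (σ π : LPart k) : Set where
      constructor eqL
      field uneq : T (σ =L= π)
    open _≐_ public

    record _⊏_ (σ π : LPart k) : Set where
      constructor lt
      field unlt : T (σ <L π)
    open _⊏_ public

    ⊑-rel : ∀ {σ π : LPart k} → σ ⊑ π → ∀ x y → T (rel σ x y) → T (rel π x y)
    ⊑-rel {σ} {π} (le p) x y =
      ⇒⁻ (allF⁻ k (allF⁻ k (∧⁻ˡ {allF k λ x → allF k λ y → rel σ x y ⇒ᵇ rel π x y} p) x) y)

    ⊑-lab : ∀ {σ π : LPart k} → σ ⊑ π → ∀ x → T (lab σ x) → T (lab π x)
    ⊑-lab {σ} {π} (le p) x =
      ⇒⁻ (allF⁻ k (∧⁻ʳ {allF k λ x → allF k λ y → rel σ x y ⇒ᵇ rel π x y} p) x)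

    mk⊑ : ∀ {σ π : LPart k} → (∀ x y → T (rel σ x y) → T (rel π x y))
        → (∀ x → T (lab σ x) → T (lab π x)) → σ ⊑ π
    mk⊑ r l = le (∧⁺ (allF⁺ k (λ x → allF⁺ k (λ y → ⇒⁺ (r x y)))) (allF⁺ k (λ x → ⇒⁺ (l x))))

    ⊑-refl : ∀ (π : LPart k) → π ⊑ π
    ⊑-refl π = mk⊑ (λ _ _ p → p) (λ _ p → p)

    ⊑-trans : ∀ {a b c : LPart k} → a ⊑ b → b ⊑ c → a ⊑ c
    ⊑-trans p q = mk⊑ (λ x y r → ⊑-rel q x y (⊑-rel p x y r)) (λ x r → ⊑-lab q x (⊑-lab p x r))

    mk≐ : ∀ {a b : LPart k} → a ⊑ b → b ⊑ a → a ≐ b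
    mk≐ {a} {b} (le p) (le q) = eqL (∧⁺ {a ≤L b} {b ≤L a} p q)

    ≐⇒⊑ : ∀ {a b : LPart k} → a ≐ b → a ⊑ b
    ≐⇒⊑ {a} {b} (eqL p) = le (∧⁻ˡ {a ≤L b} {b ≤L a} p)

    ≐⇒⊒ : ∀ {a b : LPart k} → a ≐ b → b ⊑ a
    ≐⇒⊒ {a} {b} (eqL p) = le (∧⁻ʳ {a ≤L b} {b ≤L a} p)

    ≐-refl : ∀ (a : LPart k) → a ≐ a
    ≐-refl a = mk≐ (⊑-refl a) (⊑-refl a)

    ≐-sym : ∀ {a b : LPart k} → a ≐ b → b ≐ a
    ≐-sym p = mk≐ (≐⇒⊒ p) (≐⇒⊑ p)

    ≐-trans : ∀ {a b c : LPart k} → a ≐ b → b ≐ c → a ≐ c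
    ≐-trans p q = mk≐ (⊑-trans (≐⇒⊑ p) (≐⇒⊑ q)) (⊑-trans (≐⇒⊒ q) (≐⇒⊒ p))

    ≐-rel : ∀ {a b : LPart k} → a ≐ b → ∀ x y → rel a x y ≡ rel b x y
    ≐-rel p x y = T-ext (⊑-rel (≐⇒⊑ p) x y) (⊑-rel (≐⇒⊒ p) x y)

    ≐-lab : ∀ {a b : LPart k} → a ≐ b → ∀ x → lab a x ≡ lab b x
    ≐-lab p x = T-ext (⊑-lab (≐⇒⊑ p) x) (⊑-lab (≐⇒⊒ p) x)

    ≤L-respˡ : ∀ {a a' b : LPart k} → a ≐ a' → (a ≤L b) ≡ (a' ≤L b)
    ≤L-respˡ {a} {a'} {b} p =
      T-ext (λ q → unle (⊑-trans (≐⇒⊒ p) (le {a} {b} q))) (λ q → unle (⊑-trans (≐⇒⊑ p) (le {a'} {b} q)))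

    ≤L-respʳ : ∀ {a b b' : LPart k} → b ≐ b' → (a ≤L b) ≡ (a ≤L b')
    ≤L-respʳ {a} {b} {b'} p =
      T-ext (λ q → unle (⊑-trans (le {a} {b} q) (≐⇒⊑ p))) (λ q → unle (⊑-trans (le {a} {b'} q) (≐⇒⊒ p)))

    =L-respˡ : ∀ {a a' b : LPart k} → a ≐ a' → (a =L= b) ≡ (a' =L= b)
    =L-respˡ {a} {a'} {b} p =
      T-ext (λ q → uneq (≐-trans (≐-sym p) (eqL {a} {b} q))) (λ q → uneq (≐-trans p (eqL {a'} {b} q)))

    =L-respʳ : ∀ {a b b' : LPart k} → b ≐ b' → (a =L= b) ≡ (a =L= b')
    =L-respʳ {a} {b} {b'} p =
      T-ext (λ q → uneq (≐-trans (eqL {a} {b} q) p)) (λ q → uneq (≐-trans (eqL {a} {b'} q) (≐-sym p)))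

    =L-sym : ∀ (a b : LPart k) → (a =L= b) ≡ (b =L= a)
    =L-sym a b = T-ext (λ q → uneq (≐-sym (eqL {a} {b} q))) (λ q → uneq (≐-sym (eqL {b} {a} q)))

    <L-resp : ∀ {a a' b b' : LPart k} → a ≐ a' → b ≐ b' → (a <L b) ≡ (a' <L b')
    <L-resp p q = cong₂ (λ u v → u ∧ not v) (trans (≤L-respˡ p) (≤L-respʳ q)) (trans (=L-respˡ p) (=L-respʳ q))

    ⊏⇒⊑ : ∀ {a b : LPart k} → a ⊏ b → a ⊑ b
    ⊏⇒⊑ {a} {b} (lt p) = le (∧⁻ˡ {a ≤L b} p)

    ⊏⇒≭ : ∀ {a b : LPart k} → a ⊏ b → ¬ (a ≐ b)
    ⊏⇒≭ {a} {b} (lt p) (eqL q) = not⁻ (∧⁻ʳ {a ≤L b} p) q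

    mk⊏ : ∀ {a b : LPart k} → a ⊑ b → ¬ (a ≐ b) → a ⊏ b
    mk⊏ {a} {b} (le p) q = lt (∧⁺ p (not⁺ (λ r → q (eqL {a} {b} r))))

    ⊏-irrefl : ∀ (a : LPart k) → ¬ (a ⊏ a)
    ⊏-irrefl a p = ⊏⇒≭ p (≐-refl a)

    ⊏-⊑-trans : ∀ {a b c : LPart k} → a ⊏ b → b ⊑ c → a ⊏ c
    ⊏-⊑-trans p q = mk⊏ (⊑-trans (⊏⇒⊑ p) q) (λ e → ⊏⇒≭ p (mk≐ (⊏⇒⊑ p) (⊑-trans q (≐⇒⊒ e))))

    ⊑-⊏-trans : ∀ {a b c : LPart k} → a ⊑ b → b ⊏ c → a ⊏ c
    ⊑-⊏-trans p q = mk⊏ (⊑-trans p (⊏⇒⊑ q)) (λ e → ⊏⇒≭ q (mk≐ (⊏⇒⊑ q) (⊑-trans (≐⇒⊒ e) p)))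

    _⊑?_ : ∀ (a b : LPart k) → Dec (a ⊑ b)
    a ⊑? b = map′ le unle (T? (a ≤L b))

    _≐?_ : ∀ (a b : LPart k) → Dec (a ≐ b)
    a ≐? b = map′ eqL uneq (T? (a =L= b))

    record IsLP (Y : VSet k) (π : LPart k) : Set where
      field
        lp-sub   : ∀ x y → T (rel π x y) → T (Y x) × T (Y y)
        lp-refl  : ∀ x → T (Y x) → T (rel π x x)
        lp-sym   : ∀ x y → T (rel π x y) → T (rel π y x)
        lp-labeq : ∀ x y → T (rel π x y) → lab π x ≡ lab π y
        lp-labY  : ∀ x → T (lab π x) → T (Y x)
        lp-trans : ∀ x y z → T (rel π x y) → T (rel π y z) → T (rel π x z)

    toIsLP : ∀ {Y : VSet k} {π} → T (isLPart Y π) → IsLP Y π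
    toIsLP {Y} {π} p = record
      { lp-sub   = λ x y r → let (t , _) = row x y in ∧⁻ {Y x} (⇒⁻ {rel π x y} t r)
      ; lp-refl  = λ x yx → let (_ , t , _) = row x x in ⇒⁻ {Y x} t yx
      ; lp-sym   = λ x y r → let (_ , _ , t , _) = row x y in ⇒⁻ {rel π x y} t r
      ; lp-labeq = λ x y r → let (_ , _ , _ , t , _) = row x y in ==⁻ (⇒⁻ {rel π x y} t r)
      ; lp-labY  = λ x l → let (_ , _ , _ , _ , t , _) = row x x in ⇒⁻ {lab π x} t l
      ; lp-trans = λ x y z r s → let (_ , _ , _ , _ , _ , t) = row x y in
                     ⇒⁻ {rel π x y ∧ rel π y z} (allF⁻ k t z) (∧⁺ r s)
      }
      where
      A₁ A₂ A₃ A₄ A₅ A₆ : Fin k → Fin k → Bool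
      A₁ x y = rel π x y ⇒ᵇ (Y x ∧ Y y)
      A₂ x y = Y x ⇒ᵇ rel π x x
      A₃ x y = rel π x y ⇒ᵇ rel π y x
      A₄ x y = rel π x y ⇒ᵇ (lab π x ==ᵇ lab π y)
      A₅ x y = lab π x ⇒ᵇ Y x
      A₆ x y = allF k λ z → (rel π x y ∧ rel π y z) ⇒ᵇ rel π x z
      row : ∀ x y → T (A₁ x y) × T (A₂ x y) × T (A₃ x y) × T (A₄ x y) × T (A₅ x y) × T (A₆ x y)
      row x y =
        let (t₁ , q₁) = ∧⁻ {A₁ x y} (allF⁻ k (allF⁻ k p x) y)
            (t₂ , q₂) = ∧⁻ {A₂ x y} q₁
            (t₃ , q₃) = ∧⁻ {A₃ x y} q₂
            (t₄ , q₄) = ∧⁻ {A₄ x y} q₃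
            (t₅ , t₆) = ∧⁻ {A₅ x y} q₄
        in t₁ , t₂ , t₃ , t₄ , t₅ , t₆

    fromIsLP : ∀ {Y : VSet k} {π} → IsLP Y π → T (isLPart Y π)
    fromIsLP {Y} {π} L = allF⁺ k (λ x → allF⁺ k (λ y →
        ∧⁺ (⇒⁺ (λ r → let (yx , yy) = lp-sub x y r in ∧⁺ yx yy))
       (∧⁺ (⇒⁺ (lp-refl x))
       (∧⁺ (⇒⁺ (lp-sym x y))
       (∧⁺ (⇒⁺ (λ r → ==⁺ (lp-labeq x y r)))
       (∧⁺ (⇒⁺ (lp-labY x))
           (allF⁺ k (λ z → ⇒⁺ (λ rr → lp-trans x y z (∧⁻ˡ rr) (∧⁻ʳ rr))))))))))
      where open IsLP L

    isLPart-resp : ∀ {Y : VSet k} {a b : LPart k} → a ≐ b → isLPart Y a ≡ isLPart Y b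
    isLPart-resp {Y} e = T-ext (λ p → fromIsLP (transport e (toIsLP p)))
                               (λ p → fromIsLP (transport (≐-sym e) (toIsLP p)))
      where
      transport : ∀ {a b} → a ≐ b → IsLP Y a → IsLP Y b
      transport {a} {b} e L = record
        { lp-sub   = λ x y r → lp-sub x y (back x y r)
        ; lp-refl  = λ x yx → forth x x (lp-refl x yx)
        ; lp-sym   = λ x y r → forth y x (lp-sym x y (back x y r))
        ; lp-labeq = λ x y r → trans (sym (≐-lab e x)) (trans (lp-labeq x y (back x y r)) (≐-lab e y))
        ; lp-labY  = λ x l → lp-labY x (subst T (sym (≐-lab e x)) l)
        ; lp-trans = λ x y z r s → forth x z (lp-trans x y z (back x y r) (back y z s))
        }
        where open IsLP L
              back : ∀ x y → T (rel b x y) → T (rel a x y)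
              back = ⊑-rel (≐⇒⊒ e)
              forth : ∀ x y → T (rel a x y) → T (rel b x y)
              forth = ⊑-rel (≐⇒⊑ e)

    hasLB-mono : ∀ {a b : LPart k} → a ⊑ b → T (hasLabelledBlock a) → T (hasLabelledBlock b)
    hasLB-mono e p = let (i , q) = anyF⁻ k p in anyF⁺ k i (⊑-lab e i q)

    hasLB-resp : ∀ {a b : LPart k} → a ≐ b → hasLabelledBlock a ≡ hasLabelledBlock b
    hasLB-resp e = T-ext (hasLB-mono (≐⇒⊑ e)) (hasLB-mono (≐⇒⊒ e))

    mL-resp : ∀ {a b : LPart k} → a ≐ b → mL a ≡ mL b
    mL-resp e = cong (λ z → if z ≡ᵇ 1 then _ else _) numLabelledBlocks-resp
      where
      numLabelledBlocks-resp = countF-cong k (λ x → cong₂ _∧_ (≐-lab e x)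
        (allF-cong k (λ y → cong (λ z → (toℕ y <ᵇ toℕ x) ⇒ᵇ not z) (≐-rel e x y))))

    leader : LPart k → Fin k → Bool
    leader π x = lab π x ∧ allF k (λ y → (toℕ y <ᵇ toℕ x) ⇒ᵇ not (rel π x y))

    leader⁺ : ∀ π x → T (lab π x) → (∀ y → toℕ y < toℕ x → ¬ T (rel π x y)) → T (leader π x)
    leader⁺ π x l h = ∧⁺ {lab π x} l (allF⁺ k (λ y → ⇒⁺ (λ y<x → not⁺ (h y (<ᵇ⇒< (toℕ y) (toℕ x) y<x)))))

    leader-min : ∀ π x → T (leader π x) → ∀ y → toℕ y < toℕ x → ¬ T (rel π x y)
    leader-min π x q y y<x = not⁻ (⇒⁻ (allF⁻ k {λ y → (toℕ y <ᵇ toℕ x) ⇒ᵇ not (rel π x y)}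
                                               (∧⁻ʳ {lab π x} q) y) (<⇒<ᵇ y<x))

    leader-of : ∀ {Y} π → IsLP Y π → ∀ x → T (lab π x) → ∃ λ r → T (leader π r) × T (rel π x r)
    leader-of π L x l with least k (rel π x) x (IsLP.lp-refl L x (IsLP.lp-labY L x l))
    ... | r , xr , minimal = r , leader⁺ π r (subst T (lp-labeq x r xr) l)
                                            (λ y y<r ry → minimal y y<r (lp-trans x r y xr ry)) , xr
      where open IsLP L

    leaders-unique : ∀ {Y} π → IsLP Y π → ∀ a b → T (leader π a) → T (leader π b) → T (rel π a b) → a ≡ b
    leaders-unique π L a b qa qb r with <-cmp (toℕ a) (toℕ b)
    ... | tri< a<b _ _ = ⊥-elim (leader-min π b qb a a<b (IsLP.lp-sym L a b r))
    ... | tri≈ _ eq _  = toℕ-injective eq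
    ... | tri> _ _ b<a = ⊥-elim (leader-min π a qa b b<a r)

    one-labelled-block⁺ : ∀ {Y} π → IsLP Y π → (∃ λ x → T (lab π x))
                        → (∀ x y → T (lab π x) → T (lab π y) → T (rel π x y)) → numLabelledBlocks π ≡ 1
    one-labelled-block⁺ π L (x , l) related =
      let (r , qr , _) = leader-of π L x l in
      countF≡1 k r qr (λ a b qa qb → leaders-unique π L a b qa qb
                                        (related a b (∧⁻ˡ {lab π a} qa) (∧⁻ˡ {lab π b} qb)))

    one-labelled-block⁻ : ∀ {Y} π → IsLP Y π → numLabelledBlocks π ≡ 1
                        → ∀ x y → T (lab π x) → T (lab π y) → T (rel π x y)
    one-labelled-block⁻ π L one x y lx ly =
      let (r₁ , q₁ , xr₁) = leader-of π L x lx
          (r₂ , q₂ , yr₂) = leader-of π L y ly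
          same = countF≡1-unique k one r₁ r₂ q₁ q₂
      in lp-trans x r₁ y xr₁ (lp-sym y r₁ (subst (λ z → T (rel π y z)) (sym same) yr₂))
      where open IsLP L

module FilteredLists where

  open import Defs
  open BoolReflection
  open import Data.Bool using (Bool; true; false; T)
  open import Data.Unit using (tt)
  open import Data.Nat using (_<_; _≤_; s≤s; z≤n)
  import Data.Nat.Properties as ℕP
  open import Data.List using (List; []; _∷_; length)
  open import Data.List.Membership.Propositional using (_∈_)
  open import Data.List.Relation.Unary.Any using (here; there)
  open import Data.Product using (_×_; _,_)
  open import Data.Empty using (⊥-elim)
  open import Relation.Nullary using (¬_)
  open import Relation.Binary.PropositionalEquality as P using (_≡_; refl; cong; subst)

  private variable A : Set

  filterB-cong : ∀ {p q : A → Bool} xs → (∀ x → p x ≡ q x) → filterB p xs ≡ filterB q xs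
  filterB-cong [] e = refl
  filterB-cong {q = q} (x ∷ xs) e rewrite e x with q x
  ... | true  = cong (x ∷_) (filterB-cong xs e)
  ... | false = filterB-cong xs e

  ∈-filterB⁻ : ∀ {p : A → Bool} {x} xs → x ∈ filterB p xs → x ∈ xs × T (p x)
  ∈-filterB⁻ {p = p} (y ∷ xs) m with p y in eq
  ∈-filterB⁻ (y ∷ xs) (here refl) | true = here refl , subst T (P.sym eq) tt
  ∈-filterB⁻ (y ∷ xs) (there m)   | true = let (a , b) = ∈-filterB⁻ xs m in there a , b
  ∈-filterB⁻ (y ∷ xs) m           | false = let (a , b) = ∈-filterB⁻ xs m in there a , b

  length-filterB-mono : ∀ {p q : A → Bool} xs → (∀ x → x ∈ xs → T (p x) → T (q x))
                      → length (filterB p xs) ≤ length (filterB q xs)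
  length-filterB-mono [] h = z≤n
  length-filterB-mono {p = p} {q} (x ∷ xs) h with p x in ep | q x in eq
  ... | true  | true  = s≤s (length-filterB-mono xs (λ y m → h y (there m)))
  ... | true  | false = ⊥-elim (subst T eq (h x (here refl) (subst T (P.sym ep) tt)))
  ... | false | true  = ℕP.m≤n⇒m≤1+n (length-filterB-mono xs (λ y m → h y (there m)))
  ... | false | false = length-filterB-mono xs (λ y m → h y (there m))

  length-filterB-< : ∀ {p q : A → Bool} xs → (∀ x → x ∈ xs → T (p x) → T (q x))
                   → ∀ y → y ∈ xs → T (q y) → ¬ T (p y) → length (filterB p xs) < length (filterB q xs)
  length-filterB-< (x ∷ xs) h y (here refl) qy npy rewrite ¬T⇒≡false npy | T⇒≡true qy =
    s≤s (length-filterB-mono xs (λ z m → h z (there m)))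
  length-filterB-< {p = p} {q} (x ∷ xs) h y (there m) qy npy with p x in ep | q x in eq
  ... | true  | true  = s≤s (length-filterB-< xs (λ z m → h z (there m)) y m qy npy)
  ... | true  | false = ⊥-elim (subst T eq (h x (here refl) (subst T (P.sym ep) tt)))
  ... | false | true  = ℕP.m≤n⇒m≤1+n (length-filterB-< xs (λ z m → h z (there m)) y m qy npy)
  ... | false | false = length-filterB-< xs (λ z m → h z (there m)) y m qy npy

  length-filterB-≤ : ∀ (xs : List A) → length (filterB (λ _ → true) xs) ≤ length xs
  length-filterB-≤ []       = z≤n
  length-filterB-≤ (x ∷ xs) = s≤s (length-filterB-≤ xs)

-- The enumerations of Defs list every object exactly once up to the
-- relevant equality.  This is expressed by the sifting property
--   Σ_{x ∈ xs} [a ≡ x] h(x) = h(a)   for every h respecting the equality,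
-- which is the only form in which it is used.
module Enumeration {c ℓ : Level} (Rg : CommutativeRing c ℓ) where

  open import Defs
  open BoolReflection
  open PartitionOrder
  open RingSums Rg
  open import Data.Bool using (Bool; true; false; _∧_; T)
  open import Data.Unit using (tt; ⊤)
  open import Data.Nat using (ℕ; zero; suc)
  open import Data.Fin using (Fin; zero; suc)
  open import Data.List using (List; map; concatMap)
  open import Data.Product using (_×_; _,_; proj₂)
  open import Data.List.Membership.Propositional using (_∈_)
  open FilteredLists using (∈-filterB⁻)
  open import Relation.Binary.PropositionalEquality as P using (_≡_)
  open CommutativeRing Rg hiding (zero)
  open import Relation.Binary.Reasoning.Setoid setoid

  Sifts : {A : Set} → (A → A → Bool) → List A → Set _
  Sifts {A} eq xs = ∀ (h : A → Carrier) → (∀ a b → T (eq a b) → h a ≈ h b)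
                  → ∀ a → sumL (λ x → ind (eq a x) * h x) xs ≈ h a

  eqFn : {A : Set} → (A → A → Bool) → (k : ℕ) → (Fin k → A) → (Fin k → A) → Bool
  eqFn eq k f g = allF k (λ i → eq (f i) (g i))

  eqFn-refl : {A : Set} (eq : A → A → Bool) → (∀ a → T (eq a a)) → ∀ k f → T (eqFn eq k f f)
  eqFn-refl eq r k f = allF⁺ k (λ i → r (f i))

  -- If xs enumerates A, then allFuns xs k enumerates Fin k → A: split off
  -- the value at zero and sift the two coordinates one after the other.
  sifts-allFuns : {A : Set} (eq : A → A → Bool) → (∀ a → T (eq a a))
                → ∀ xs → Sifts eq xs → ∀ k → Sifts (eqFn eq k) (allFuns xs k)
  sifts-allFuns eq r xs en zero H rH f = trans (+-identityʳ _) (trans (*-identityˡ _) (rH _ f tt))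
  sifts-allFuns {A} eq r xs en (suc k) H rH f = begin
    sumL (λ x → ind (eqFn eq (suc k) f x) * H x) (concatMap (λ a → map (consF a) (allFuns xs k)) xs)
      ≈⟨ sumL-concatMap _ _ xs ⟩
    sumL (λ a → sumL (λ x → ind (eqFn eq (suc k) f x) * H x) (map (consF a) (allFuns xs k))) xs
      ≈⟨ sumL-cong xs (λ a → sumL-map _ (consF a) (allFuns xs k)) ⟩
    sumL (λ a → sumL (λ g → ind (eq f₀ a ∧ eqFn eq k f₊ g) * H (consF a g)) (allFuns xs k)) xs
      ≈⟨ sumL-cong xs (λ a → sumL-cong (allFuns xs k) (λ g → sym (ind-∧* (eq f₀ a) _ _))) ⟩
    sumL (λ a → sumL (λ g → ind (eq f₀ a) * (ind (eqFn eq k f₊ g) * H (consF a g))) (allFuns xs k)) xs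
      ≈⟨ sumL-cong xs (λ a → sym (sumL-*ˡ _ _ (allFuns xs k))) ⟩
    sumL (λ a → ind (eq f₀ a) * sumL (λ g → ind (eqFn eq k f₊ g) * H (consF a g)) (allFuns xs k)) xs
      ≈⟨ sumL-cong xs (λ a → *-congˡ (sifts-allFuns eq r xs en k (λ g → H (consF a g))
                                         (λ g g' e → rH _ _ (∧⁺ (r a) e)) f₊)) ⟩
    sumL (λ a → ind (eq f₀ a) * H (consF a f₊)) xs
      ≈⟨ en (λ a → H (consF a f₊)) (λ a b e → rH _ _ (∧⁺ e (eqFn-refl eq r k f₊))) f₀ ⟩
    H (consF f₀ f₊)
      ≈⟨ rH _ _ (allF⁺ (suc k) consF-eta) ⟩
    H f ∎
    where
    f₀ : A
    f₀ = f zero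
    f₊ : Fin k → A
    f₊ i = f (suc i)
    consF-eta : ∀ i → T (eq (consF f₀ f₊ i) (f i))
    consF-eta zero    = r f₀
    consF-eta (suc i) = r (f₊ i)

  ==ᵇ-refl : ∀ a → T (a ==ᵇ a)
  ==ᵇ-refl true  = tt
  ==ᵇ-refl false = tt

  sifts-bools : Sifts _==ᵇ_ bools
  sifts-bools h rh true  = trans (+-cong (*-identityˡ _) (trans (+-identityʳ _) (zeroˡ _))) (+-identityʳ _)
  sifts-bools h rh false = trans (+-cong (zeroˡ _) (trans (+-identityʳ _) (*-identityˡ _))) (+-identityˡ _)

  sifts-subsets : ∀ k → Sifts (eqFn _==ᵇ_ k) (allSubsets k)
  sifts-subsets k = sifts-allFuns _==ᵇ_ ==ᵇ-refl bools sifts-bools k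

  SiftsL : {k : ℕ} → List (LPart k) → (LPart k → Set) → Set _
  SiftsL {k} xs C = ∀ (h : LPart k → Carrier) → (∀ a b → a ≐ b → h a ≈ h b)
                  → ∀ π → C π → sumL (λ σ → ind (π =L= σ) * h σ) xs ≈ h π

  siftsL-filter : ∀ {k} xs C (q : LPart k → Bool) → SiftsL xs C → (∀ a b → a ≐ b → q a ≡ q b)
                → SiftsL (filterB q xs) (λ π → C π × T (q π))
  siftsL-filter xs C q U rq h rh π (cπ , qπ) = begin
    sumL (λ σ → ind (π =L= σ) * h σ) (filterB q xs)         ≈⟨ sumL-filter _ q xs ⟩
    sumL (λ σ → ind (q σ) * (ind (π =L= σ) * h σ)) xs       ≈⟨ sumL-cong xs (λ σ → *-swapˡ _ _ _) ⟩
    sumL (λ σ → ind (π =L= σ) * (ind (q σ) * h σ)) xs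
      ≈⟨ U (λ σ → ind (q σ) * h σ) (λ a b e → *-cong (ind-≡ (rq a b e)) (rh a b e)) π cπ ⟩
    ind (q π) * h π                                          ≈⟨ ind-T* (h π) qπ ⟩
    h π                                                      ∎

  module _ {k : ℕ} where

    private
      eqS : VSet k → VSet k → Bool
      eqS = eqFn _==ᵇ_ k

      eqS-refl : ∀ a → T (eqS a a)
      eqS-refl = eqFn-refl _==ᵇ_ ==ᵇ-refl k

      eqR : (Fin k → VSet k) → (Fin k → VSet k) → Bool
      eqR = eqFn eqS k

      candidates : List (LPart k)
      candidates = concatMap (λ r → map (lp r) (allSubsets k)) (allFuns (allSubsets k) k)

      ≐⇒eq : ∀ {a b : LPart k} → a ≐ b → T (eqR (rel a) (rel b)) × T (eqS (lab a) (lab b))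
      ≐⇒eq e = allF⁺ k (λ x → allF⁺ k (λ y → ==⁺ (≐-rel e x y))) , allF⁺ k (λ x → ==⁺ (≐-lab e x))

      eq⇒≐ : ∀ {a b : LPart k} → T (eqR (rel a) (rel b)) → T (eqS (lab a) (lab b)) → a ≐ b
      eq⇒≐ {a} {b} r l = mk≐ (mk⊑ (λ x y → P.subst T (R x y)) (λ x → P.subst T (L x)))
                             (mk⊑ (λ x y → P.subst T (P.sym (R x y))) (λ x → P.subst T (P.sym (L x))))
        where
        R : ∀ x y → rel a x y ≡ rel b x y
        R x y = ==⁻ (allF⁻ k (allF⁻ k r x) y)
        L : ∀ x → lab a x ≡ lab b x
        L x = ==⁻ (allF⁻ k l x)

      ind-=L : ∀ (π : LPart k) r l → ind (π =L= lp r l) ≈ ind (eqR (rel π) r) * ind (eqS (lab π) l)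
      ind-=L π r l = trans (ind-≡ (T-ext (λ q → let (a , b) = ≐⇒eq (eqL {σ = π} {π = lp r l} q) in ∧⁺ a b)
                                         (λ q → uneq (eq⇒≐ {a = π} {b = lp r l} (∧⁻ˡ {eqR (rel π) r} q) (∧⁻ʳ {eqR (rel π) r} q)))))
                           (ind-∧ (eqR (rel π) r) (eqS (lab π) l))

      sifts-candidates : SiftsL candidates (λ _ → ⊤)
      sifts-candidates h rh π _ = begin
        sumL (λ σ → ind (π =L= σ) * h σ) candidates ≈⟨ sumL-concatMap _ _ rels ⟩
        sumL (λ r → sumL (λ σ → ind (π =L= σ) * h σ) (map (lp r) (allSubsets k))) rels
          ≈⟨ sumL-cong rels (λ r → sumL-map _ (lp r) (allSubsets k)) ⟩
        sumL (λ r → sumL (λ l → ind (π =L= lp r l) * h (lp r l)) (allSubsets k)) rels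
          ≈⟨ sumL-cong rels (λ r → sumL-cong (allSubsets k) (λ l → trans (*-congʳ (ind-=L π r l)) (*-assoc _ _ _))) ⟩
        sumL (λ r → sumL (λ l → ind (eqR (rel π) r) * (ind (eqS (lab π) l) * h (lp r l))) (allSubsets k)) rels
          ≈⟨ sumL-cong rels (λ r → sym (sumL-*ˡ _ _ (allSubsets k))) ⟩
        sumL (λ r → ind (eqR (rel π) r) * sumL (λ l → ind (eqS (lab π) l) * h (lp r l)) (allSubsets k)) rels
          ≈⟨ sumL-cong rels (λ r → *-congˡ (sifts-subsets k (λ l → h (lp r l))
                (λ l l' e → rh _ _ (eq⇒≐ {a = lp r l} {b = lp r l'} (eqFn-refl eqS eqS-refl k r) e)) (lab π))) ⟩
        sumL (λ r → ind (eqR (rel π) r) * h (lp r (lab π))) rels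
          ≈⟨ sifts-allFuns eqS eqS-refl (allSubsets k) (sifts-subsets k) k (λ r → h (lp r (lab π)))
                (λ r r' e → rh _ _ (eq⇒≐ {a = lp r (lab π)} {b = lp r' (lab π)} e (eqS-refl (lab π)))) (rel π) ⟩
        h π ∎
        where rels = allFuns (allSubsets k) k

    sifts-ΠL : ∀ (Y : VSet k) → SiftsL (ΠL Y) (λ π → ⊤ × T (isLPart Y π))
    sifts-ΠL Y = siftsL-filter candidates _ (isLPart Y) sifts-candidates (λ a b e → isLPart-resp {Y = Y} e)

    ∈ΠL⇒isLPart : ∀ {Y : VSet k} {π} → π ∈ ΠL Y → T (isLPart Y π)
    ∈ΠL⇒isLPart {Y} m = proj₂ (∈-filterB⁻ {p = isLPart Y} candidates m)

-- Möbius inversion on a finite list Pl of labelled partitions, for the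
-- Möbius function mobiusFuel Pl of Defs (computed in ℤ by the recursion
-- μ(π,π) = 1, μ(π,σ) = -Σ_{π ≤ τ < σ} μ(π,τ)).
--   * the recursion gives Σ_{ρ≤τ≤σ} μ(ρ,τ) = [ρ = σ]   (μ ζ = 1);
--   * from it, by induction on the number of elements above ρ, also
--     Σ_{ρ≤π≤σ} μ(π,σ) = [ρ = σ]                       (ζ μ = 1);
--   * hence for every upward closed Q ⊆ Pl and λ(π) = Σ_{σ∈Q, σ≥π} μ(π,σ) m(σ):
--     Σ_{π∈Q, π≥ρ} λ(π) = m(ρ) for ρ ∈ Q.
module Mobius where

  open import Defs
  open BoolReflection
  open PartitionOrder
  open import Data.Integer.Properties using (+-*-commutativeRing)
  open RingSums +-*-commutativeRing
  open Enumeration +-*-commutativeRing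
  open FilteredLists
  open import Data.Bool using (Bool; _∧_; if_then_else_; T)
  open import Data.Bool.Properties using (T?)
  open import Data.Unit using (tt)
  open import Data.Nat as ℕ using (ℕ; zero; suc; _<_)
  import Data.Nat.Properties as ℕP
  open import Data.Integer as ℤ using (ℤ; +_)
  open import Data.List using (List; []; _∷_; length)
  open import Data.List.Membership.Propositional using (_∈_)
  open import Data.Product using (_,_; proj₁)
  open import Relation.Nullary using (¬_; yes; no)
  open import Relation.Binary.PropositionalEquality as P using (_≡_; refl; cong; cong₂)
  open import Algebra.Bundles using (CommutativeRing)
  open CommutativeRing +-*-commutativeRing hiding (zero; refl)
  open import Algebra.Properties.Group +-group using (identityˡ-unique)
  open import Relation.Binary.Reasoning.Setoid setoid

  private variable A : Set

  sumℤ≡sumL : ∀ (f : A → ℤ) xs → sumℤ f xs ≡ sumL f xs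
  sumℤ≡sumL f []       = refl
  sumℤ≡sumL f (x ∷ xs) = cong (λ z → f x + z) (sumℤ≡sumL f xs)

  module Mob {k : ℕ} (Pl : List (LPart k)) (C : LPart k → Set)
             (sifts : SiftsL Pl C) (memC : ∀ x → x ∈ Pl → C x) where

    μ : LPart k → LPart k → ℤ
    μ = mobiusFuel Pl (suc (length Pl))

    interval : LPart k → LPart k → LPart k → Bool
    interval π σ τ = (π ≤L τ) ∧ (τ ≤L σ)

    between : LPart k → LPart k → LPart k → Bool
    between π σ τ = (π ≤L τ) ∧ (τ <L σ)

    -- Number of elements strictly below τ, strictly above ρ: the measures for
    -- the recursion of μ and for the induction proving ζ μ = 1.
    below : LPart k → ℕ
    below τ = length (filterB (λ x → x <L τ) Pl)

    above : LPart k → ℕ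
    above ρ = length (filterB (λ x → ρ <L x) Pl)

    below-mono : ∀ {τ' τ} → τ' ∈ Pl → τ' ⊏ τ → below τ' < below τ
    below-mono {τ'} m l = length-filterB-< Pl (λ x _ p → unlt (⊏-⊑-trans (lt {σ = x} {π = τ'} p) (⊏⇒⊑ l)))
                            τ' m (unlt l) (λ p → ⊏-irrefl τ' (lt p))

    below-bound : ∀ {τ} → τ ∈ Pl → below τ < length Pl
    below-bound {τ} m = ℕP.<-≤-trans (length-filterB-< Pl (λ _ _ _ → tt) τ m tt (λ p → ⊏-irrefl τ (lt p)))
                                     (length-filterB-≤ Pl)

    above-mono : ∀ {ρ τ} → τ ∈ Pl → ρ ⊏ τ → above τ < above ρ
    above-mono {τ = τ} m l = length-filterB-< Pl (λ x _ p → unlt (⊑-⊏-trans (⊏⇒⊑ l) (lt {σ = τ} {π = x} p)))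
                               τ m (unlt l) (λ p → ⊏-irrefl τ (lt p))

    fuel-stable : ∀ f π τ → below τ < f → mobiusFuel Pl f π τ ≡ mobiusFuel Pl (suc f) π τ
    fuel-stable (suc f) π τ b = cong (λ z → if π =L= τ then + 1 else if π ≤L τ then ℤ.- z else + 0)
      (P.trans (sumℤ≡sumL _ (filterB (between π τ) Pl))
      (P.trans (sumL-cong∈ (filterB (between π τ) Pl) same)
               (P.sym (sumℤ≡sumL _ (filterB (between π τ) Pl)))))
      where
      same : ∀ τ' → τ' ∈ filterB (between π τ) Pl → mobiusFuel Pl f π τ' ≡ mobiusFuel Pl (suc f) π τ'
      same τ' m = let (m' , p) = ∈-filterB⁻ Pl m in
        fuel-stable f π τ' (ℕP.<-≤-trans (below-mono m' (lt (∧⁻ʳ {π ≤L τ'} p))) (ℕP.≤-pred b))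

    μ-sum : ∀ π σ → sumℤ (mobiusFuel Pl (length Pl) π) (filterB (between π σ) Pl)
                  ≡ sumL (λ τ → ind (between π σ τ) * μ π τ) Pl
    μ-sum π σ = P.trans (sumℤ≡sumL _ (filterB (between π σ) Pl))
       (P.trans (sumL-cong∈ (filterB (between π σ) Pl)
                  (λ τ m → fuel-stable (length Pl) π τ (below-bound (proj₁ (∈-filterB⁻ Pl m)))))
                (sumL-filter (μ π) (between π σ) Pl))

    μ-refl : ∀ {π σ} → π ≐ σ → μ π σ ≡ + 1
    μ-refl {π} {σ} e = if-true {b = π =L= σ} (uneq e)

    μ-rec : ∀ {π σ} → σ ∈ Pl → ¬ (π ≐ σ) → π ⊑ σ → μ π σ ≡ - sumL (λ τ → ind (between π σ τ) * μ π τ) Pl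
    μ-rec {π} {σ} m ne l = P.trans (if-false {b = π =L= σ} (λ q → ne (eqL q)))
                           (P.trans (if-true {b = π ≤L σ} (unle l)) (cong -_ (μ-sum π σ)))

    fuel-respˡ : ∀ f σ {π π'} → π ≐ π' → mobiusFuel Pl f π σ ≡ mobiusFuel Pl f π' σ
    fuel-respˡ zero    σ e = refl
    fuel-respˡ (suc f) σ {π} {π'} e =
      cong₂ (λ b₁ rest → if b₁ then + 1 else rest) (=L-respˡ {b = σ} e)
        (cong₂ (λ b₂ s → if b₂ then - s else + 0) (≤L-respˡ {b = σ} e)
          (P.trans (cong (sumℤ (mobiusFuel Pl f π))
                         (filterB-cong Pl (λ τ → cong (λ z → z ∧ (τ <L σ)) (≤L-respˡ {b = τ} e))))
                   (P.trans (sumℤ≡sumL _ (filterB (between π' σ) Pl))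
                   (P.trans (sumL-cong (filterB (between π' σ) Pl) (λ τ → fuel-respˡ f τ e))
                            (P.sym (sumℤ≡sumL _ (filterB (between π' σ) Pl)))))))

    fuel-respʳ : ∀ f π {σ σ'} → σ ≐ σ' → mobiusFuel Pl f π σ ≡ mobiusFuel Pl f π σ'
    fuel-respʳ zero    π e = refl
    fuel-respʳ (suc f) π {σ} {σ'} e =
      cong₂ (λ b₁ rest → if b₁ then + 1 else rest) (=L-respʳ {a = π} e)
        (cong₂ (λ b₂ s → if b₂ then - s else + 0) (≤L-respʳ {a = π} e)
          (cong (sumℤ (mobiusFuel Pl f π))
                (filterB-cong Pl (λ τ → cong ((π ≤L τ) ∧_) (<L-resp (≐-refl τ) e)))))

    μ-respˡ : ∀ σ {π π'} → π ≐ π' → μ π σ ≡ μ π' σ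
    μ-respˡ = fuel-respˡ (suc (length Pl))

    μ-respʳ : ∀ π {σ σ'} → σ ≐ σ' → μ π σ ≡ μ π σ'
    μ-respʳ = fuel-respʳ (suc (length Pl))

    -- μ ζ = 1: Σ_{ρ≤τ≤σ} μ(ρ,τ) = [ρ = σ].  For ρ < σ the term τ = σ is
    -- split off; by the recursion it cancels the rest.
    μζ≡1 : ∀ {ρ σ} → C ρ → σ ∈ Pl → sumL (λ τ → ind (interval ρ σ τ) * μ ρ τ) Pl ≡ ind (ρ =L= σ)
    μζ≡1 {ρ} {σ} cρ mσ with ρ ≐? σ
    ... | yes e = begin
        sumL (λ τ → ind (interval ρ σ τ) * μ ρ τ) Pl
          ≈⟨ sumL-cong Pl (λ τ → cong (λ w → ind ((ρ ≤L τ) ∧ w) * μ ρ τ) (≤L-respʳ {a = τ} (≐-sym e))) ⟩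
        sumL (λ τ → ind (ρ =L= τ) * μ ρ τ) Pl  ≈⟨ sifts (μ ρ) (λ a b e' → μ-respʳ ρ e') ρ cρ ⟩
        μ ρ ρ                                  ≈⟨ μ-refl (≐-refl ρ) ⟩
        + 1                                    ≈⟨ sym (ind-T (uneq e)) ⟩
        ind (ρ =L= σ)                          ∎
    ... | no ne with ρ ⊑? σ
    ...   | yes l = begin
        sumL (λ τ → ind (interval ρ σ τ) * μ ρ τ) Pl
          ≈⟨ sumL-cong Pl split-top ⟩
        sumL (λ τ → ind (between ρ σ τ) * μ ρ τ + ind (σ =L= τ) * (ind (ρ ≤L τ) * μ ρ τ)) Pl
          ≈⟨ sumL-+ _ _ Pl ⟩
        S + sumL (λ τ → ind (σ =L= τ) * (ind (ρ ≤L τ) * μ ρ τ)) Pl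
          ≈⟨ cong (λ z → S + z) (sifts (λ τ → ind (ρ ≤L τ) * μ ρ τ)
                   (λ a b e' → cong₂ (λ u v → ind u * v) (≤L-respʳ {a = ρ} e') (μ-respʳ ρ e')) σ (memC σ mσ)) ⟩
        S + ind (ρ ≤L σ) * μ ρ σ               ≈⟨ cong (λ z → S + z) (P.trans (ind-T* (μ ρ σ) (unle l)) (μ-rec mσ ne l)) ⟩
        S + - S                                ≈⟨ -‿inverseʳ S ⟩
        + 0                                    ≈⟨ sym (ind-F (λ q → ne (eqL q))) ⟩
        ind (ρ =L= σ)                          ∎
      where
      S = sumL (λ τ → ind (between ρ σ τ) * μ ρ τ) Pl
      split-top : ∀ τ → ind (interval ρ σ τ) * μ ρ τ
                      ≡ ind (between ρ σ τ) * μ ρ τ + ind (σ =L= τ) * (ind (ρ ≤L τ) * μ ρ τ)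
      split-top τ = begin
        ind (interval ρ σ τ) * μ ρ τ
          ≈⟨ cong (_* μ ρ τ) (ind-split-top (ρ ≤L τ) (τ ≤L σ) (τ =L= σ) (λ q → unle (≐⇒⊑ (eqL {σ = τ} {π = σ} q)))) ⟩
        (ind (between ρ σ τ) + ind (τ =L= σ) * ind (ρ ≤L τ)) * μ ρ τ
          ≈⟨ distribʳ (μ ρ τ) (ind (between ρ σ τ)) (ind (τ =L= σ) * ind (ρ ≤L τ)) ⟩
        ind (between ρ σ τ) * μ ρ τ + (ind (τ =L= σ) * ind (ρ ≤L τ)) * μ ρ τ
          ≈⟨ cong (λ z → ind (between ρ σ τ) * μ ρ τ + z) reorder ⟩
        ind (between ρ σ τ) * μ ρ τ + ind (σ =L= τ) * (ind (ρ ≤L τ) * μ ρ τ) ∎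
        where
        reorder : (ind (τ =L= σ) * ind (ρ ≤L τ)) * μ ρ τ ≡ ind (σ =L= τ) * (ind (ρ ≤L τ) * μ ρ τ)
        reorder = P.trans (*-assoc (ind (τ =L= σ)) (ind (ρ ≤L τ)) (μ ρ τ))
                          (cong (λ w → ind w * (ind (ρ ≤L τ) * μ ρ τ)) (=L-sym τ σ))
    ...   | no nl = P.trans (sumL-0 Pl (λ τ → ind-F* (μ ρ τ) (λ q → nl (through τ q))))
                            (sym (ind-F (λ q → nl (≐⇒⊑ (eqL {σ = ρ} {π = σ} q)))))
      where
      through : ∀ τ → T (interval ρ σ τ) → ρ ⊑ σ
      through τ q = ⊑-trans (le {σ = ρ} {π = τ} (∧⁻ˡ {ρ ≤L τ} q)) (le (∧⁻ʳ {ρ ≤L τ} q))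

    ζμ : LPart k → LPart k → ℤ
    ζμ ρ σ = sumL (λ π → ind (interval ρ σ π) * μ π σ) Pl

    ζμ-respˡ : ∀ σ {ρ ρ'} → ρ ≐ ρ' → ζμ ρ σ ≡ ζμ ρ' σ
    ζμ-respˡ σ e = sumL-cong Pl (λ π → cong (λ w → ind (w ∧ (π ≤L σ)) * μ π σ) (≤L-respˡ {b = π} e))

    ζμ-outside : ∀ {ρ} σ → ¬ (ρ ⊑ σ) → ζμ ρ σ ≡ + 0
    ζμ-outside {ρ} σ nl = sumL-0 Pl (λ π → ind-F* (μ π σ)
      (λ q → let (a , b) = ∧⁻ {ρ ≤L π} q in nl (⊑-trans (le a) (le b))))

    interval-regroup : ∀ ρ σ τ π → (interval ρ σ τ ∧ interval τ σ π) ≡ (interval ρ σ π ∧ interval ρ π τ)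
    interval-regroup ρ σ τ π = T-ext forth back
      where
      forth : T (interval ρ σ τ ∧ interval τ σ π) → T (interval ρ σ π ∧ interval ρ π τ)
      forth q = let (ab , cd) = ∧⁻ {interval ρ σ τ} q
                    (a , b) = ∧⁻ {ρ ≤L τ} ab
                    (c , d) = ∧⁻ {τ ≤L π} cd
                in ∧⁺ {interval ρ σ π} (∧⁺ {ρ ≤L π} (unle (⊑-trans (le {σ = ρ} a) (le c))) d) (∧⁺ {ρ ≤L τ} a c)
      back : T (interval ρ σ π ∧ interval ρ π τ) → T (interval ρ σ τ ∧ interval τ σ π)
      back q = let (ab , cd) = ∧⁻ {interval ρ σ π} q
                   (a , b) = ∧⁻ {ρ ≤L π} ab
                   (c , d) = ∧⁻ {ρ ≤L τ} cd
               in ∧⁺ {interval ρ σ τ} (∧⁺ {ρ ≤L τ} c (unle (⊑-trans (le {σ = τ} d) (le b)))) (∧⁺ {τ ≤L π} d b)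

    -- The convolution Σ_{ρ≤τ≤σ} μ(ρ,τ) ζμ(τ,σ), evaluated in two ways below.
    conv : LPart k → LPart k → ℤ
    conv ρ σ = sumL (λ τ → ind (interval ρ σ τ) * (μ ρ τ * ζμ τ σ)) Pl

    -- First way: exchange the sums and apply μ ζ = 1 to the inner one.
    conv-by-μζ : ∀ {ρ} σ → C ρ → conv ρ σ ≡ ind (ρ ≤L σ) * μ ρ σ
    conv-by-μζ {ρ} σ cρ = begin
      conv ρ σ
        ≈⟨ sumL-cong Pl (λ τ → P.trans (cong (ind (interval ρ σ τ) *_) (sumL-*ˡ (μ ρ τ) (λ π → ind (interval τ σ π) * μ π σ) Pl))
                             (sumL-*ˡ (ind (interval ρ σ τ)) (λ π → μ ρ τ * (ind (interval τ σ π) * μ π σ)) Pl)) ⟩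
      sumL (λ τ → sumL (λ π → ind (interval ρ σ τ) * (μ ρ τ * (ind (interval τ σ π) * μ π σ))) Pl) Pl
        ≈⟨ sumL-cong Pl (λ τ → sumL-cong Pl (λ π → gather τ π)) ⟩
      sumL (λ τ → sumL (λ π → ind (interval ρ σ τ ∧ interval τ σ π) * (μ ρ τ * μ π σ)) Pl) Pl
        ≈⟨ sumL-swap _ Pl Pl ⟩
      sumL (λ π → sumL (λ τ → ind (interval ρ σ τ ∧ interval τ σ π) * (μ ρ τ * μ π σ)) Pl) Pl
        ≈⟨ sumL-cong Pl (λ π → sumL-cong Pl (λ τ → scatter τ π)) ⟩
      sumL (λ π → sumL (λ τ → ind (interval ρ σ π) * (μ π σ * (ind (interval ρ π τ) * μ ρ τ))) Pl) Pl
        ≈⟨ sumL-cong Pl (λ π → P.sym (P.trans (cong (ind (interval ρ σ π) *_) (sumL-*ˡ (μ π σ) (λ τ → ind (interval ρ π τ) * μ ρ τ) Pl))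
                             (sumL-*ˡ (ind (interval ρ σ π)) (λ τ → μ π σ * (ind (interval ρ π τ) * μ ρ τ)) Pl))) ⟩
      sumL (λ π → ind (interval ρ σ π) * (μ π σ * sumL (λ τ → ind (interval ρ π τ) * μ ρ τ) Pl)) Pl
        ≈⟨ sumL-cong∈ Pl (λ π m → cong (λ w → ind (interval ρ σ π) * (μ π σ * w)) (μζ≡1 cρ m)) ⟩
      sumL (λ π → ind (interval ρ σ π) * (μ π σ * ind (ρ =L= π))) Pl
        ≈⟨ sumL-cong Pl (λ π → P.trans (cong (ind (interval ρ σ π) *_) (*-comm (μ π σ) (ind (ρ =L= π))))
                             (*-swapˡ (ind (interval ρ σ π)) (ind (ρ =L= π)) (μ π σ))) ⟩
      sumL (λ π → ind (ρ =L= π) * (ind (interval ρ σ π) * μ π σ)) Pl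
        ≈⟨ sifts (λ π → ind (interval ρ σ π) * μ π σ)
             (λ p p' e → cong₂ (λ u v → ind u * v) (cong₂ _∧_ (≤L-respʳ {a = ρ} e) (≤L-respˡ {b = σ} e)) (μ-respˡ σ e)) ρ cρ ⟩
      ind (interval ρ σ ρ) * μ ρ σ
        ≈⟨ cong (λ w → ind w * μ ρ σ) (T-ext (∧⁻ʳ {ρ ≤L ρ}) (∧⁺ (unle (⊑-refl ρ)))) ⟩
      ind (ρ ≤L σ) * μ ρ σ ∎
      where
      gather : ∀ τ π → ind (interval ρ σ τ) * (μ ρ τ * (ind (interval τ σ π) * μ π σ))
                     ≡ ind (interval ρ σ τ ∧ interval τ σ π) * (μ ρ τ * μ π σ)
      gather τ π = P.trans (cong (ind (interval ρ σ τ) *_) (*-swapˡ (μ ρ τ) (ind (interval τ σ π)) (μ π σ)))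
                           (ind-∧* (interval ρ σ τ) (interval τ σ π) (μ ρ τ * μ π σ))
      scatter : ∀ τ π → ind (interval ρ σ τ ∧ interval τ σ π) * (μ ρ τ * μ π σ)
                      ≡ ind (interval ρ σ π) * (μ π σ * (ind (interval ρ π τ) * μ ρ τ))
      scatter τ π = begin
        ind (interval ρ σ τ ∧ interval τ σ π) * (μ ρ τ * μ π σ)
          ≈⟨ cong (λ w → ind w * (μ ρ τ * μ π σ)) (interval-regroup ρ σ τ π) ⟩
        ind (interval ρ σ π ∧ interval ρ π τ) * (μ ρ τ * μ π σ)
          ≈⟨ P.sym (ind-∧* (interval ρ σ π) (interval ρ π τ) (μ ρ τ * μ π σ)) ⟩
        ind (interval ρ σ π) * (ind (interval ρ π τ) * (μ ρ τ * μ π σ))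
          ≈⟨ cong (ind (interval ρ σ π) *_) (P.trans (P.sym (*-assoc (ind (interval ρ π τ)) (μ ρ τ) (μ π σ)))
                                                     (*-comm (ind (interval ρ π τ) * μ ρ τ) (μ π σ))) ⟩
        ind (interval ρ σ π) * (μ π σ * (ind (interval ρ π τ) * μ ρ τ)) ∎

    -- Second way: split off τ = ρ; for τ > ρ assume ζμ(τ,σ) = [τ = σ].
    conv-by-IH : ∀ {ρ σ} → C ρ → σ ∈ Pl → (∀ τ → τ ∈ Pl → ρ ⊏ τ → ζμ τ σ ≡ ind (τ =L= σ))
               → conv ρ σ ≡ ind (ρ ≤L σ) * (μ ρ ρ * ζμ ρ σ) + ind (ρ <L σ) * μ ρ σ
    conv-by-IH {ρ} {σ} cρ mσ IH = begin
      conv ρ σ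
        ≈⟨ sumL-cong Pl split-bottom ⟩
      sumL (λ τ → ind (ρ =L= τ) * (ind (τ ≤L σ) * g τ) + ind ((ρ <L τ) ∧ (τ ≤L σ)) * g τ) Pl
        ≈⟨ sumL-+ _ _ Pl ⟩
      sumL (λ τ → ind (ρ =L= τ) * (ind (τ ≤L σ) * g τ)) Pl + sumL (λ τ → ind ((ρ <L τ) ∧ (τ ≤L σ)) * g τ) Pl
        ≈⟨ cong₂ _+_ (sifts (λ τ → ind (τ ≤L σ) * g τ)
                        (λ p p' e → cong₂ (λ u v → ind u * v) (≤L-respˡ {b = σ} e) (cong₂ _*_ (μ-respʳ ρ e) (ζμ-respˡ σ e))) ρ cρ)
                     (P.trans (sumL-cong∈ Pl above-ρ)
                        (sifts (λ τ → ind (ρ <L τ) * μ ρ τ)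
                           (λ p p' e → cong₂ (λ u v → ind u * v) (<L-resp (≐-refl ρ) e) (μ-respʳ ρ e)) σ (memC σ mσ))) ⟩
      ind (ρ ≤L σ) * (μ ρ ρ * ζμ ρ σ) + ind (ρ <L σ) * μ ρ σ ∎
      where
      g : LPart k → ℤ
      g τ = μ ρ τ * ζμ τ σ
      split-bottom : ∀ τ → ind (interval ρ σ τ) * g τ
                         ≡ ind (ρ =L= τ) * (ind (τ ≤L σ) * g τ) + ind ((ρ <L τ) ∧ (τ ≤L σ)) * g τ
      split-bottom τ = begin
        ind (interval ρ σ τ) * g τ
          ≈⟨ cong (_* g τ) (ind-split-bottom (ρ ≤L τ) (τ ≤L σ) (ρ =L= τ) (λ q → unle (≐⇒⊑ (eqL {σ = ρ} {π = τ} q)))) ⟩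
        (ind (ρ =L= τ) * ind (τ ≤L σ) + ind ((ρ <L τ) ∧ (τ ≤L σ))) * g τ
          ≈⟨ distribʳ (g τ) (ind (ρ =L= τ) * ind (τ ≤L σ)) (ind ((ρ <L τ) ∧ (τ ≤L σ))) ⟩
        (ind (ρ =L= τ) * ind (τ ≤L σ)) * g τ + ind ((ρ <L τ) ∧ (τ ≤L σ)) * g τ
          ≈⟨ cong (_+ ind ((ρ <L τ) ∧ (τ ≤L σ)) * g τ) (*-assoc (ind (ρ =L= τ)) (ind (τ ≤L σ)) (g τ)) ⟩
        ind (ρ =L= τ) * (ind (τ ≤L σ) * g τ) + ind ((ρ <L τ) ∧ (τ ≤L σ)) * g τ ∎
      above-ρ : ∀ τ → τ ∈ Pl → ind ((ρ <L τ) ∧ (τ ≤L σ)) * g τ ≡ ind (σ =L= τ) * (ind (ρ <L τ) * μ ρ τ)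
      above-ρ τ m with T? (ρ <L τ)
      ... | no nq = P.trans (ind-F* (g τ) (λ r → nq (∧⁻ˡ r)))
                            (P.sym (P.trans (cong (ind (σ =L= τ) *_) (ind-F* (μ ρ τ) nq)) (zeroʳ (ind (σ =L= τ)))))
      ... | yes q rewrite T⇒≡true q | IH τ m (lt q) | =L-sym σ τ with τ ≐? σ
      ...   | yes e rewrite T⇒≡true (uneq e) | T⇒≡true (unle (≐⇒⊑ e)) = cong (+ 1 *_) (*-comm (μ ρ τ) (+ 1))
      ...   | no ne rewrite ¬T⇒≡false (λ r → ne (eqL r)) = P.trans (cong (ind (τ ≤L σ) *_) (zeroʳ (μ ρ τ))) (zeroʳ (ind (τ ≤L σ)))

    conv-compare : ∀ {ρ σ} → C ρ → σ ∈ Pl → ρ ⊑ σ → (∀ τ → τ ∈ Pl → ρ ⊏ τ → ζμ τ σ ≡ ind (τ =L= σ))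
                 → ζμ ρ σ + ind (ρ <L σ) * μ ρ σ ≡ μ ρ σ
    conv-compare {ρ} {σ} cρ mσ l IH = begin
      ζμ ρ σ + ind (ρ <L σ) * μ ρ σ
        ≈⟨ cong (λ z → z + ind (ρ <L σ) * μ ρ σ)
             (P.sym (P.trans (ind-T* _ (unle l)) (P.trans (cong (_* ζμ ρ σ) (μ-refl (≐-refl ρ))) (*-identityˡ _)))) ⟩
      ind (ρ ≤L σ) * (μ ρ ρ * ζμ ρ σ) + ind (ρ <L σ) * μ ρ σ  ≈⟨ P.sym (conv-by-IH cρ mσ IH) ⟩
      conv ρ σ                                                  ≈⟨ conv-by-μζ σ cρ ⟩
      ind (ρ ≤L σ) * μ ρ σ                                      ≈⟨ ind-T* _ (unle l) ⟩
      μ ρ σ                                                     ∎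

    -- The induction step: [ρ < σ] is 0 if ρ = σ and 1 otherwise.
    ζμ-step : ∀ {ρ σ} → C ρ → σ ∈ Pl → ρ ⊑ σ → (∀ τ → τ ∈ Pl → ρ ⊏ τ → ζμ τ σ ≡ ind (τ =L= σ))
            → ζμ ρ σ ≡ ind (ρ =L= σ)
    ζμ-step {ρ} {σ} cρ mσ l IH with ρ ≐? σ
    ... | yes e = begin
        ζμ ρ σ                          ≈⟨ P.sym (P.trans (cong (λ z → ζμ ρ σ + z * μ ρ σ) (ind-F (λ q → ⊏⇒≭ (lt q) e)))
                                                           (+-identityʳ (ζμ ρ σ))) ⟩
        ζμ ρ σ + ind (ρ <L σ) * μ ρ σ   ≈⟨ conv-compare cρ mσ l IH ⟩
        μ ρ σ                           ≈⟨ μ-refl e ⟩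
        + 1                             ≈⟨ P.sym (ind-T (uneq e)) ⟩
        ind (ρ =L= σ)                   ∎
    ... | no ne = P.trans (identityˡ-unique (ζμ ρ σ) (μ ρ σ)
                            (P.trans (cong (λ z → ζμ ρ σ + z) (P.sym (ind-T* (μ ρ σ) (unlt (mk⊏ l ne)))))
                                     (conv-compare cρ mσ l IH)))
                          (P.sym (ind-F (λ q → ne (eqL q))))

    ζμ≡1 : ∀ {ρ σ} → C ρ → σ ∈ Pl → ζμ ρ σ ≡ ind (ρ =L= σ)
    ζμ≡1 {ρ} {σ} cρ mσ = go (suc (above ρ)) ρ ℕP.≤-refl cρ
      where
      go : ∀ n ρ → above ρ < n → C ρ → ζμ ρ σ ≡ ind (ρ =L= σ)
      go (suc n) ρ bound cρ with ρ ⊑? σ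
      ... | no nl = P.trans (ζμ-outside σ nl) (P.sym (ind-F (λ q → nl (≐⇒⊑ (eqL {σ = ρ} {π = σ} q)))))
      ... | yes l = ζμ-step cρ mσ l (λ τ m l' → go n τ (ℕP.<-≤-trans (above-mono m l') (ℕP.≤-pred bound)) (memC τ m))

    module Inversion (q : LPart k → Bool) (q-resp : ∀ a b → a ≐ b → q a ≡ q b)
                     (q-up : ∀ {a b} → a ⊑ b → T (q a) → T (q b)) where

      Q : List (LPart k)
      Q = filterB q Pl

      λQ : LPart k → ℤ
      λQ π = sumℤ (λ σ → μ π σ ℤ.* mL σ) (filterB (λ σ → π ≤L σ) Q)

      -- for ρ ∈ Q the whole interval [ρ,σ] lies in Q
      ζμ-in-Q : ∀ ρ σ → T (q ρ) → sumL (λ π → ind (interval ρ σ π) * μ π σ) Q ≡ ζμ ρ σ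
      ζμ-in-Q ρ σ qρ = P.trans (sumL-filter _ q Pl) (sumL-cong Pl drop-test)
        where
        drop-test : ∀ π → ind (q π) * (ind (interval ρ σ π) * μ π σ) ≡ ind (interval ρ σ π) * μ π σ
        drop-test π with ρ ⊑? π
        ... | yes p = ind-T* _ (q-up p qρ)
        ... | no np = P.trans (cong (ind (q π) *_) outside) (P.trans (zeroʳ (ind (q π))) (P.sym outside))
          where outside : ind (interval ρ σ π) * μ π σ ≡ + 0
                outside = ind-F* (μ π σ) (λ r → np (le (∧⁻ˡ {ρ ≤L π} r)))

      inversion : ∀ ρ → C ρ → T (q ρ) → sumL (λ π → ind (ρ ≤L π) * λQ π) Q ≡ mL ρ
      inversion ρ cρ qρ = begin
        sumL (λ π → ind (ρ ≤L π) * λQ π) Q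
          ≈⟨ sumL-cong Q (λ π → cong (ind (ρ ≤L π) *_)
               (P.trans (sumℤ≡sumL _ (filterB (λ σ → π ≤L σ) Q)) (sumL-filter _ (λ σ → π ≤L σ) Q))) ⟩
        sumL (λ π → ind (ρ ≤L π) * sumL (λ σ → ind (π ≤L σ) * (μ π σ * mL σ)) Q) Q
          ≈⟨ sumL-cong Q (λ π → P.trans (sumL-*ˡ (ind (ρ ≤L π)) _ Q)
                                        (sumL-cong Q (λ σ → ind-∧* (ρ ≤L π) (π ≤L σ) (μ π σ * mL σ)))) ⟩
        sumL (λ π → sumL (λ σ → ind (interval ρ σ π) * (μ π σ * mL σ)) Q) Q
          ≈⟨ sumL-swap _ Q Q ⟩
        sumL (λ σ → sumL (λ π → ind (interval ρ σ π) * (μ π σ * mL σ)) Q) Q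
          ≈⟨ sumL-cong Q (λ σ → P.trans (sumL-cong Q (λ π → P.trans (P.sym (*-assoc (ind (interval ρ σ π)) (μ π σ) (mL σ)))
                                                                     (*-comm _ (mL σ))))
                                        (P.sym (sumL-*ˡ (mL σ) _ Q))) ⟩
        sumL (λ σ → mL σ * sumL (λ π → ind (interval ρ σ π) * μ π σ) Q) Q
          ≈⟨ sumL-cong∈ Q (λ σ m → cong (mL σ *_) (P.trans (ζμ-in-Q ρ σ qρ) (ζμ≡1 cρ (proj₁ (∈-filterB⁻ Pl m))))) ⟩
        sumL (λ σ → mL σ * ind (ρ =L= σ)) Q
          ≈⟨ sumL-cong Q (λ σ → *-comm (mL σ) (ind (ρ =L= σ))) ⟩
        sumL (λ σ → ind (ρ =L= σ) * mL σ) Q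
          ≈⟨ siftsL-filter Pl C q sifts q-resp mL (λ a b e → mL-resp e) ρ (cρ , qρ) ⟩
        mL ρ ∎

-- The main point is that k steps always suffice, which makes conn
-- an equivalence relation.
module Walks where

  open import Defs
  open BoolReflection
  open import Data.Bool using (true; false; _∧_; not; T)
  open import Data.Bool.Properties using (T?)
  open import Data.Unit using (tt)
  open import Data.Nat as ℕ using (ℕ; zero; suc; _+_; _≤_; s≤s)
  import Data.Nat.Properties as ℕP
  open import Data.Fin using (Fin; zero; suc)
  open import Data.Product using (_×_; _,_; proj₁; proj₂; ∃)
  open import Data.Sum using (_⊎_; inj₁; inj₂)
  open import Data.Empty using (⊥-elim)
  open import Relation.Nullary using (¬_; yes; no)
  open import Relation.Binary.PropositionalEquality using (_≡_; refl; sym; trans; cong; subst; subst₂)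

  module Walk {k e : ℕ} (ends : Fin e → Fin k × Fin k) where

    e₁ e₂ : Fin e → Fin k
    e₁ d = proj₁ (ends d)
    e₂ d = proj₂ (ends d)

    Joins : Fin e → Fin k → Fin k → Set
    Joins d u v = (e₁ d ≡ u × e₂ d ≡ v) ⊎ (e₂ d ≡ u × e₁ d ≡ v)

    joins-sym : ∀ {d u v} → Joins d u v → Joins d v u
    joins-sym (inj₁ (p , q)) = inj₂ (q , p)
    joins-sym (inj₂ (p , q)) = inj₁ (q , p)

    joins-ends : ∀ {d u v} (P : Fin k → Set) → P (e₁ d) × P (e₂ d) → Joins d u v → P u × P v
    joins-ends P (p₁ , p₂) (inj₁ (refl , refl)) = p₁ , p₂
    joins-ends P (p₁ , p₂) (inj₂ (refl , refl)) = p₂ , p₁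

    reach-refl : ∀ F t u → T (reach ends F t u u)
    reach-refl F zero    u = =F⁺ {x = u} refl
    reach-refl F (suc t) u = ∨⁺ˡ {u =F= u} (=F⁺ {x = u} refl)

    reach-≡ : ∀ F t u v → u ≡ v → T (reach ends F t u v)
    reach-≡ F t u .u refl = reach-refl F t u

    reach-step⁻ : ∀ F t u v → T (reach ends F (suc t) u v)
                → u ≡ v ⊎ ∃ λ d → ∃ λ u' → T (F d) × Joins d u u' × T (reach ends F t u' v)
    reach-step⁻ F t u v p with ∨⁻ {u =F= v} p
    ... | inj₁ q = inj₁ (=F⁻ q)
    ... | inj₂ q with anyF⁻ e q
    ...   | d , r with ∧⁻ {F d} r
    ...     | fd , s with ∨⁻ {(e₁ d =F= u) ∧ reach ends F t (e₂ d) v} s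
    ...       | inj₁ a = inj₂ (d , e₂ d , fd , inj₁ (=F⁻ (∧⁻ˡ {e₁ d =F= u} a) , refl) , ∧⁻ʳ {e₁ d =F= u} a)
    ...       | inj₂ a = inj₂ (d , e₁ d , fd , inj₂ (=F⁻ (∧⁻ˡ {e₂ d =F= u} a) , refl) , ∧⁻ʳ {e₂ d =F= u} a)

    reach-step⁺ : ∀ F t {d u u'} v → T (F d) → Joins d u u' → T (reach ends F t u' v) → T (reach ends F (suc t) u v)
    reach-step⁺ F t {d} {u} v fd (inj₁ (eq , refl)) r = ∨⁺ʳ {u =F= v} (anyF⁺ e d (∧⁺ {F d} fd
      (∨⁺ˡ {(e₁ d =F= u) ∧ reach ends F t (e₂ d) v} (∧⁺ {e₁ d =F= u} (=F⁺ eq) r))))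
    reach-step⁺ F t {d} {u} v fd (inj₂ (eq , refl)) r = ∨⁺ʳ {u =F= v} (anyF⁺ e d (∧⁺ {F d} fd
      (∨⁺ʳ {(e₁ d =F= u) ∧ reach ends F t (e₂ d) v} (∧⁺ {e₂ d =F= u} (=F⁺ eq) r))))

    reach-step-mono : ∀ F F' t s v → (∀ d → T (F d) → T (F' d))
                    → (∀ w → T (reach ends F t w v) → T (reach ends F' s w v))
                    → ∀ u → T (reach ends F (suc t) u v) → T (reach ends F' (suc s) u v)
    reach-step-mono F F' t s v hF h u p with reach-step⁻ F t u v p
    ... | inj₁ eq = reach-≡ F' (suc s) u v eq
    ... | inj₂ (d , u' , fd , j , r) = reach-step⁺ F' s v (hF d fd) j (h u' r)

    reach-monoF : ∀ F F' → (∀ d → T (F d) → T (F' d)) → ∀ t u v → T (reach ends F t u v) → T (reach ends F' t u v)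
    reach-monoF F F' hF zero    u v p = p
    reach-monoF F F' hF (suc t) u v p = reach-step-mono F F' t t v hF (λ w → reach-monoF F F' hF t w v) u p

    reach-suc : ∀ F t u v → T (reach ends F t u v) → T (reach ends F (suc t) u v)
    reach-suc F zero    u v p = ∨⁺ˡ {u =F= v} p
    reach-suc F (suc t) u v p = reach-step-mono F F t (suc t) v (λ _ x → x) (λ w → reach-suc F t w v) u p

    reach-+ : ∀ F j t u v → T (reach ends F t u v) → T (reach ends F (j + t) u v)
    reach-+ F zero    t u v p = p
    reach-+ F (suc j) t u v p = reach-suc F (j + t) u v (reach-+ F j t u v p)

    reach-≤ : ∀ F {t s} → t ≤ s → ∀ u v → T (reach ends F t u v) → T (reach ends F s u v)
    reach-≤ F {t} {s} t≤s u v p = subst (λ z → T (reach ends F z u v)) (ℕP.m∸n+n≡m t≤s) (reach-+ F (s ℕ.∸ t) t u v p)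

    reach-trans : ∀ F t s u v w → T (reach ends F t u v) → T (reach ends F s v w) → T (reach ends F (t + s) u w)
    reach-trans F zero s u v w p q = subst (λ z → T (reach ends F s z w)) (sym (=F⁻ p)) q
    reach-trans F (suc t) s u v w p q with reach-step⁻ F t u v p
    ... | inj₁ refl = reach-≤ F (ℕP.m≤n+m s (suc t)) u w q
    ... | inj₂ (d , u' , fd , j , r) = reach-step⁺ F (t + s) w fd j (reach-trans F t s u' v w r q)

    reach-edge : ∀ F {d u v} → T (F d) → Joins d u v → T (reach ends F 1 u v)
    reach-edge F {v = v} fd j = reach-step⁺ F 0 v fd j (reach-refl F 0 v)

    reach-sym : ∀ F t u v → T (reach ends F t u v) → T (reach ends F t v u)
    reach-sym F zero u v p = reach-≡ F 0 v u (sym (=F⁻ p))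
    reach-sym F (suc t) u v p with reach-step⁻ F t u v p
    ... | inj₁ eq = reach-≡ F (suc t) v u (sym eq)
    ... | inj₂ (d , u' , fd , j , r) = reach-≤ F (ℕP.≤-reflexive (ℕP.+-comm t 1)) v u
            (reach-trans F t 1 v u' u (reach-sym F t u' v r) (reach-edge F fd (joins-sym j)))

    -- Walks of length ≤ k suffice.  The set of vertices reaching v within t
    -- steps grows strictly with t until it stabilises, and it has at most k
    -- elements.

    Stable : VSet e → Fin k → ℕ → Set
    Stable F v s = ∀ w → T (reach ends F (suc s) w v) → T (reach ends F s w v)

    stable-forever : ∀ F v t → Stable F v t → ∀ j w → T (reach ends F (j + t) w v) → T (reach ends F t w v)
    stable-forever F v t st zero    w p = p
    stable-forever F v t st (suc j) w p = st w (reach-step-mono F F (j + t) t v (λ _ x → x) (stable-forever F v t st j) w p)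

    stable-or-growing : ∀ F v t → (∃ λ s → s ≤ t × Stable F v s) ⊎ (suc t ≤ countF k (λ w → reach ends F t w v))
    stable-or-growing F v zero = inj₂ (countF-pos k v (reach-refl F 0 v))
    stable-or-growing F v (suc t) with stable-or-growing F v t
    ... | inj₁ (s , s≤t , st) = inj₁ (s , ℕP.m≤n⇒m≤1+n s≤t , st)
    ... | inj₂ c with T? (allF k (λ w → reach ends F (suc t) w v ⇒ᵇ reach ends F t w v))
    ...   | yes y = inj₁ (t , ℕP.n≤1+n t , (λ w → ⇒⁻ (allF⁻ k y w)))
    ...   | no n with ¬allF⇒∃¬ k n
    ...     | w , nw with T? (reach ends F (suc t) w v) | T? (reach ends F t w v)
    ...       | yes a | no b  = inj₂ (ℕP.≤-trans (s≤s c) (countF-strict k (λ x → reach-suc F t x v) w a b))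
    ...       | yes a | yes b = ⊥-elim (nw (⇒⁺ (λ _ → b)))
    ...       | no a  | _     = ⊥-elim (nw (⇒⁺ (λ p → ⊥-elim (a p))))

    reach-shorten : ∀ F t u v → T (reach ends F t u v) → T (reach ends F k u v)
    reach-shorten F t u v p with stable-or-growing F v k
    ... | inj₂ c = ⊥-elim (ℕP.<-irrefl refl (ℕP.<-≤-trans c (countF-≤ k _)))
    ... | inj₁ (s , s≤k , st) = reach-≤ F s≤k u v (stable-forever F v s st t u (reach-≤ F (ℕP.m≤m+n t s) u v p))

    Conn : VSet e → Fin k → Fin k → Set
    Conn F u v = T (conn ends F u v)

    conn-refl : ∀ F u → Conn F u u
    conn-refl F u = reach-refl F k u

    conn-sym : ∀ F {u v} → Conn F u v → Conn F v u
    conn-sym F {u} {v} p = reach-sym F k u v p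

    conn-trans : ∀ F {u v w} → Conn F u v → Conn F v w → Conn F u w
    conn-trans F {u} {v} {w} p q = reach-shorten F (k + k) u w (reach-trans F k k u v w p q)

    conn-edge : ∀ F {d u v} → T (F d) → Joins d u v → Conn F u v
    conn-edge F {u = u} {v} fd j = reach-shorten F 1 u v (reach-edge F fd j)

    conn-monoF : ∀ F F' → (∀ d → T (F d) → T (F' d)) → ∀ {u v} → Conn F u v → Conn F' u v
    conn-monoF F F' h {u} {v} p = reach-monoF F F' h k u v p

    conn-ext : ∀ F F' → (∀ d → F d ≡ F' d) → ∀ u v → conn ends F u v ≡ conn ends F' u v
    conn-ext F F' h u v = T-ext (conn-monoF F F' (λ d p → subst T (h d) p))
                                (conn-monoF F' F (λ d p → subst T (sym (h d)) p))

  module Contract {k e : ℕ} (ends : Fin e → Fin k × Fin k) (X : VSet k) where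
    open Walk ends public
    private module C = Walk (contrEnds X ends)

    cV : Fin k → Fin (suc k)
    cV = contrV X

    cV-suc : ∀ a u → cV a ≡ suc u → a ≡ u
    cV-suc a u eq with X a
    cV-suc a u ()   | true
    cV-suc a u refl | false = refl

    cV-X : ∀ {a} → T (X a) → cV a ≡ zero
    cV-X {a} xa with X a
    ... | true = refl

    cV-notX : ∀ {a} → ¬ T (X a) → cV a ≡ suc a
    cV-notX {a} n with X a
    ... | true  = ⊥-elim (n tt)
    ... | false = refl

    ReachesX : VSet e → VSet k → Set
    ReachesX F K' = ∀ u → T (K' u) → ¬ T (X u) → ∃ λ x → T (X x) × Conn F u x

    joins-contract : ∀ {d u v} → Joins d u v → C.Joins d (cV u) (cV v)
    joins-contract (inj₁ (refl , refl)) = inj₁ (refl , refl)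
    joins-contract (inj₂ (refl , refl)) = inj₂ (refl , refl)

    joins-uncontract : ∀ {d u w} → C.Joins d (suc u) w → ∃ λ u' → Joins d u u' × cV u' ≡ w
    joins-uncontract {d} {u} (inj₁ (eq , refl)) = e₂ d , inj₁ (cV-suc (e₁ d) u eq , refl) , refl
    joins-uncontract {d} {u} (inj₂ (eq , refl)) = e₁ d , inj₂ (cV-suc (e₂ d) u eq , refl) , refl

    walk-to-X : ∀ F t u → T (reach (contrEnds X ends) (contrF X ends F) t (cV u) zero) → ∃ λ x → T (X x) × Conn F u x
    walk-to-X F t u p with T? (X u)
    ... | yes xu = u , xu , conn-refl F u
    ... | no nxu = go t (subst (λ z → T (reach (contrEnds X ends) (contrF X ends F) t z zero)) (cV-notX nxu) p)
      where
      go : ∀ t → T (reach (contrEnds X ends) (contrF X ends F) t (suc u) zero) → ∃ λ x → T (X x) × Conn F u x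
      go zero q with =F⁻ {x = suc u} {y = zero} q
      ... | ()
      go (suc t) q with C.reach-step⁻ (contrF X ends F) t (suc u) zero q
      ... | inj₁ ()
      ... | inj₂ (d , w , fd , j , r) with joins-uncontract j
      ...   | u' , j' , refl with walk-to-X F t u' r
      ...     | x , xx , c = x , xx , conn-trans F (conn-edge F (∧⁻ˡ {F d} fd) j') c

    -- Contraction maps walks to walks (an edge inside X becomes a no-op).
    walk-contract : ∀ F t a b → T (reach ends F t a b) → T (reach (contrEnds X ends) (contrF X ends F) t (cV a) (cV b))
    walk-contract F zero a b p = C.reach-≡ (contrF X ends F) 0 (cV a) (cV b) (cong cV (=F⁻ p))
    walk-contract F (suc t) a b p with reach-step⁻ F t a b p
    ... | inj₁ eq = C.reach-≡ (contrF X ends F) (suc t) (cV a) (cV b) (cong cV eq)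
    ... | inj₂ (d , a' , fd , j , r) with T? (X (e₁ d) ∧ X (e₂ d))
    ...   | yes both = C.reach-suc (contrF X ends F) t (cV a) (cV b)
                         (subst (λ z → T (reach (contrEnds X ends) (contrF X ends F) t z (cV b)))
                                (trans (proj₂ same) (sym (proj₁ same))) (walk-contract F t a' b r))
      where same = joins-ends (λ z → cV z ≡ zero) (cV-X (∧⁻ˡ {X (e₁ d)} both) , cV-X (∧⁻ʳ {X (e₁ d)} both)) j
    ...   | no nb = C.reach-step⁺ (contrF X ends F) t (cV b) (∧⁺ {F d} fd (not⁺ nb)) (joins-contract j)
                      (walk-contract F t a' b r)

    contracted-M⇒ReachesX : ∀ F K' → T (Mconn (contrEnds X ends) (contrF X ends F) (contrSet X K')) → ReachesX F K'
    contracted-M⇒ReachesX F K' m u ku nxu =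
      walk-to-X F (suc k) u (subst (λ z → T (reach (contrEnds X ends) (contrF X ends F) (suc k) z zero)) (sym (cV-notX nxu)) c)
      where
      S = contrSet X K'
      Cn = conn (contrEnds X ends) (contrF X ends F)
      c : T (Cn (suc u) zero)
      c = ⇒⁻ {S (suc u) ∧ S zero} (allF⁻ (suc k) {f = λ v → (S (suc u) ∧ S v) ⇒ᵇ Cn (suc u) v}
             (allF⁻ (suc k) {f = λ u' → allF (suc k) λ v → (S u' ∧ S v) ⇒ᵇ Cn u' v} m (suc u)) zero)
             (∧⁺ {K' u ∧ not (X u)} (∧⁺ {K' u} ku (not⁺ nxu)) tt)

    ReachesX⇒contracted-M : ∀ F K' → ReachesX F K' → T (Mconn (contrEnds X ends) (contrF X ends F) (contrSet X K'))
    ReachesX⇒contracted-M F K' h = allF⁺ (suc k) (λ u' → allF⁺ (suc k) (λ v' → ⇒⁺ (λ s →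
        C.conn-trans F' (to-zero u' (∧⁻ˡ {contrSet X K' u'} s)) (C.conn-sym F' (to-zero v' (∧⁻ʳ {contrSet X K' u'} s))))))
      where
      F' = contrF X ends F
      to-zero : ∀ u' → T (contrSet X K' u') → C.Conn F' u' zero
      to-zero zero    _ = C.conn-refl F' zero
      to-zero (suc u) s with h u (∧⁻ˡ {K' u} s) (not⁻ (∧⁻ʳ {K' u} s))
      ... | x , xx , c = C.reach-shorten F' k (suc u) zero
            (subst₂ (λ a b → T (reach (contrEnds X ends) F' k a b))
                    (cV-notX (not⁻ (∧⁻ʳ {K' u} s))) (cV-X xx) (walk-contract F k u x c))

-- The key tool is that an F-walk alternates between the two sides and
-- can only change side inside X.
module Splitting where

  open import Defs
  open BoolReflection
  open PartitionOrder
  open Walks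
  open import Data.Bool using (Bool; true; _∧_; _∨_; T)
  open import Data.Bool.Properties using (T?)
  open import Data.Unit using (tt)
  open import Data.Nat as ℕ using (ℕ; zero; suc)
  open import Data.Fin using (Fin)
  open import Data.Product using (_×_; _,_; proj₁; ∃)
  open import Data.Sum using (_⊎_; inj₁; inj₂)
  open import Data.Empty using (⊥-elim)
  open import Relation.Nullary using (¬_; yes; no)
  open import Relation.Binary.PropositionalEquality using (_≡_; refl; sym; subst)

  module ComponentPartition {k e : ℕ} (ends : Fin e → Fin k × Fin k) where
    open Walk ends

    module _ (F : VSet e) (W K' Y : VSet k) where

      cp : LPart k
      cp = compPart ends F W K' ⊓ Y

      rel-cp⁻ : ∀ u v → T (rel cp u v) → T (Y u) × T (Y v) × T (W u) × T (W v) × Conn F u v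
      rel-cp⁻ u v p =
        let (a , p₁) = ∧⁻ {Y u} p
            (b , p₂) = ∧⁻ {Y v} p₁
            (c , p₃) = ∧⁻ {W u} p₂
            (d , p₄) = ∧⁻ {W v} p₃
        in a , b , c , d , p₄

      rel-cp⁺ : ∀ u v → T (Y u) → T (Y v) → T (W u) → T (W v) → Conn F u v → T (rel cp u v)
      rel-cp⁺ u v a b c d p = ∧⁺ {Y u} a (∧⁺ {Y v} b (∧⁺ {W u} c (∧⁺ {W v} d p)))

      lab-cp⁻ : ∀ u → T (lab cp u) → T (Y u) × T (W u) × ∃ λ w → T (K' w) × Conn F u w
      lab-cp⁻ u p =
        let (a , p₁) = ∧⁻ {Y u} p
            (b , p₂) = ∧⁻ {W u} p₁
            (w , q) = anyF⁻ k p₂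
            (c , d) = ∧⁻ {K' w} q
        in a , b , w , c , d

      lab-cp⁺ : ∀ u w → T (Y u) → T (W u) → T (K' w) → Conn F u w → T (lab cp u)
      lab-cp⁺ u w a b c d = ∧⁺ {Y u} a (∧⁺ {W u} b (anyF⁺ k {λ w → K' w ∧ conn ends F u w} w (∧⁺ {K' w} c d)))

      cp-isLP : (∀ x → T (Y x) → T (W x)) → T (isLPart Y cp)
      cp-isLP Y⊆W = fromIsLP {Y = Y} {π = cp} (record
        { lp-sub   = λ x y r → let (a , b , _) = rel-cp⁻ x y r in a , b
        ; lp-refl  = λ x yx → rel-cp⁺ x x yx yx (Y⊆W x yx) (Y⊆W x yx) (conn-refl F x)
        ; lp-sym   = λ x y r → let (a , b , c , d , f) = rel-cp⁻ x y r in rel-cp⁺ y x b a d c (conn-sym F f)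
        ; lp-labeq = λ x y r → let (a , b , c , d , f) = rel-cp⁻ x y r in
            T-ext (λ l → let (_ , _ , w , kw , g) = lab-cp⁻ x l in lab-cp⁺ y w b d kw (conn-trans F (conn-sym F f) g))
                  (λ l → let (_ , _ , w , kw , g) = lab-cp⁻ y l in lab-cp⁺ x w a c kw (conn-trans F f g))
        ; lp-labY  = λ x l → proj₁ (lab-cp⁻ x l)
        ; lp-trans = λ x y z r s → let (a , b , c , d , f) = rel-cp⁻ x y r
                                       (_ , b' , _ , d' , f') = rel-cp⁻ y z s
                                   in rel-cp⁺ x z a b' c d' (conn-trans F f f')
        })

  module KSplitting (G : Multigraph) (K V1 V2 : VSet (Multigraph.n G)) (E1 E2 : VSet (Multigraph.m G))
                    (S : IsKSplitting G K V1 V2 E1 E2) where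
    open Multigraph G
    open IsKSplitting S
    open Walk ends
    open ComponentPartition ends
    private module C = Contract ends (V1 ∩ᵛ V2)

    X : VSet n
    X = V1 ∩ᵛ V2

    allV : VSet n
    allV _ = true

    πX : LPart n
    πX = lp (λ x y → X x ∧ X y ∧ (x =F= y)) (λ x → X x ∧ K x)

    data Side : Set where
      ₁ ₂ : Side

    other : Side → Side
    other ₁ = ₂
    other ₂ = ₁

    V : Side → VSet n
    V ₁ = V1
    V ₂ = V2

    E : Side → VSet m
    E ₁ = E1
    E ₂ = E2

    Kof : Side → VSet n
    Kof i = K ∩ᵛ V i

    X⇒V : ∀ i {x} → T (X x) → T (V i x)
    X⇒V ₁ {x} p = ∧⁻ˡ {V1 x} p
    X⇒V ₂ {x} p = ∧⁻ʳ {V1 x} p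

    mkX : ∀ i {x} → T (V i x) → T (V (other i) x) → T (X x)
    mkX ₁ a b = ∧⁺ a b
    mkX ₂ a b = ∧⁺ b a

    same-side-or-X : ∀ i j {x} → T (V i x) → T (V j x) → i ≡ j ⊎ T (X x)
    same-side-or-X ₁ ₁ a b = inj₁ refl
    same-side-or-X ₁ ₂ a b = inj₂ (mkX ₁ a b)
    same-side-or-X ₂ ₁ a b = inj₂ (mkX ₂ a b)
    same-side-or-X ₂ ₂ a b = inj₁ refl

    E-ends : ∀ i d → T (E i d) → T (V i (e₁ d)) × T (V i (e₂ d))
    E-ends ₁ = sub1
    E-ends ₂ = sub2

    K≠∅ : ∀ i → ∃ λ v → T (K v ∧ V i v)
    K≠∅ ₁ = K1≠∅
    K≠∅ ₂ = K2≠∅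

    π : Side → VSet m → LPart n
    π i Fi = cp Fi (V i) (Kof i) X

    M : Side → VSet m → Bool
    M i Fi = Mconn (contrEnds X ends) (contrF X ends Fi) (contrSet X (Kof i))

    π-isLP : ∀ i Fi → T (isLPart X (π i Fi))
    π-isLP i Fi = cp-isLP Fi (V i) (Kof i) X (λ x → X⇒V i)

    πX⊑π : ∀ i Fi → πX ⊑ π i Fi
    πX⊑π i Fi = mk⊑
      (λ x y r → let (a , r') = ∧⁻ {X x} r ; (b , c) = ∧⁻ {X y} r' in
         subst (λ z → T (rel (π i Fi) x z)) (=F⁻ c) (rel-cp⁺ Fi (V i) (Kof i) X x x a a (X⇒V i a) (X⇒V i a) (conn-refl Fi x)))
      (λ x l → let (a , b) = ∧⁻ {X x} l in
         lab-cp⁺ Fi (V i) (Kof i) X x x a (X⇒V i a) (∧⁺ {K x} b (X⇒V i a)) (conn-refl Fi x))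

    M⇒ReachesX : ∀ i Fi → T (M i Fi) → C.ReachesX Fi (Kof i)
    M⇒ReachesX i Fi = C.contracted-M⇒ReachesX Fi (Kof i)

    K-reaches-X : ∀ i Fi → T (M i Fi) → ∀ v → T (Kof i v) → ∃ λ x → T (X x) × Conn Fi x v
    K-reaches-X i Fi m v kv with T? (X v)
    ... | yes xv = v , xv , conn-refl Fi v
    ... | no nxv = let (x , xx , c) = M⇒ReachesX i Fi m v kv nxv in x , xx , conn-sym Fi c

    π-hasLB : ∀ i Fi → T (M i Fi) → T (hasLabelledBlock (π i Fi))
    π-hasLB i Fi m = let (v , kv) = K≠∅ i ; (x , xx , c) = K-reaches-X i Fi m v kv in
      anyF⁺ n x (lab-cp⁺ Fi (V i) (Kof i) X x v xx (X⇒V i xx) kv c)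

    module Joined (F1 F2 : VSet m) (F1⊆E1 : ∀ d → T (F1 d) → T (E1 d)) (F2⊆E2 : ∀ d → T (F2 d) → T (E2 d)) where

      Fof : Side → VSet m
      Fof ₁ = F1
      Fof ₂ = F2

      F : VSet m
      F d = F1 d ∨ F2 d

      Fof⊆F : ∀ i d → T (Fof i d) → T (F d)
      Fof⊆F ₁ d p = ∨⁺ˡ {F1 d} p
      Fof⊆F ₂ d p = ∨⁺ʳ {F1 d} p

      Fof-ends : ∀ i d → T (Fof i d) → T (V i (e₁ d)) × T (V i (e₂ d))
      Fof-ends ₁ d p = E-ends ₁ d (F1⊆E1 d p)
      Fof-ends ₂ d p = E-ends ₂ d (F2⊆E2 d p)

      F-side : ∀ d → T (F d) → ∃ λ i → T (Fof i d)
      F-side d p with ∨⁻ {F1 d} p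
      ... | inj₁ q = ₁ , q
      ... | inj₂ q = ₂ , q

      πᵢ : Side → LPart n
      πᵢ i = π i (Fof i)

      Mᵢ : Side → Bool
      Mᵢ i = M i (Fof i)

      ρ : LPart n
      ρ = cp F allV K X

      MF : Bool
      MF = Mconn ends F K

      MF-conn : T MF → ∀ u v → T (K u) → T (K v) → Conn F u v
      MF-conn mf u v ku kv = ⇒⁻ {K u ∧ K v}
        (allF⁻ n {λ v → (K u ∧ K v) ⇒ᵇ conn ends F u v} (allF⁻ n {λ u → allF n λ v → (K u ∧ K v) ⇒ᵇ conn ends F u v} mf u) v)
        (∧⁺ {K u} ku kv)

      ρ-isLP : T (isLPart X ρ)
      ρ-isLP = cp-isLP F allV K X (λ x _ → tt)

      π⊑ρ : ∀ i → πᵢ i ⊑ ρ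
      π⊑ρ i = mk⊑
        (λ x y r → let (a , b , _ , _ , f) = rel-cp⁻ (Fof i) (V i) (Kof i) X x y r in
           rel-cp⁺ F allV K X x y a b tt tt (conn-monoF (Fof i) F (Fof⊆F i) f))
        (λ x l → let (a , _ , w , kw , f) = lab-cp⁻ (Fof i) (V i) (Kof i) X x l in
           lab-cp⁺ F allV K X x w a tt (∧⁻ˡ {K w} kw) (conn-monoF (Fof i) F (Fof⊆F i) f))

      πX⊑ρ : πX ⊑ ρ
      πX⊑ρ = ⊑-trans (πX⊑π ₁ F1) (π⊑ρ ₁)

      ρ-hasLB : T (Mᵢ ₁) → T (hasLabelledBlock ρ)
      ρ-hasLB m₁ = hasLB-mono (π⊑ρ ₁) (π-hasLB ₁ F1 m₁)

      edge-side : ∀ {d u u'} → T (F d) → Joins d u u' → ∃ λ i → T (Fof i d) × T (V i u) × T (V i u')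
      edge-side {d} fd j = let (i , fi) = F-side d fd in i , fi , joins-ends (λ z → T (V i z)) (Fof-ends i d fi) j

      -- An F-walk starting on side i outside X and ending elsewhere first
      -- reaches X through Fᵢ: an F-edge at a vertex of side i outside X is
      -- an Fᵢ-edge.
      exit-through-X : ∀ i t u w → T (reach ends F t u w) → T (V i u) → ¬ T (X u) → ¬ (T (V i w) × ¬ T (X w))
                     → ∃ λ x → T (X x) × Conn (Fof i) u x
      exit-through-X i zero u w p vu nxu n = ⊥-elim (n (subst (λ z → T (V i z) × ¬ T (X z)) (=F⁻ p) (vu , nxu)))
      exit-through-X i (suc t) u w p vu nxu n with reach-step⁻ F t u w p
      ... | inj₁ refl = ⊥-elim (n (vu , nxu))
      ... | inj₂ (d , u' , fd , jn , r) with edge-side fd jn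
      ...   | j , fj , vju , vju' with same-side-or-X i j vu vju
      ...     | inj₂ xu = ⊥-elim (nxu xu)
      ...     | inj₁ refl with T? (X u')
      ...       | yes xu' = u' , xu' , conn-edge (Fof i) fj jn
      ...       | no nxu' = let (x , xx , c) = exit-through-X i t u' w r vju' nxu' n in
                            x , xx , conn-trans (Fof i) (conn-edge (Fof i) fj jn) c

      -- M(H, K) implies M(Hᵢ_X, Kᵢ_X): a vertex of Kᵢ outside X is joined
      -- to a vertex of K on the other side, and that walk leaves side i
      -- through X.
      MF⇒M : ∀ i → T MF → T (Mᵢ i)
      MF⇒M i mf = C.ReachesX⇒contracted-M (Fof i) (Kof i) reaches
        where
        reaches : C.ReachesX (Fof i) (Kof i)
        reaches u ku nxu =
          let (w , kw) = K≠∅ (other i) in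
          exit-through-X i n u w (MF-conn mf u w (∧⁻ˡ {K u} ku) (∧⁻ˡ {K w} kw)) (∧⁻ʳ {K u} ku) nxu
            (λ (vw , nxw) → nxw (mkX i vw (∧⁻ʳ {K w} kw)))

      -- Propagating a property φ of X backwards along F-walks, for φ closed
      -- under Fᵢ-connectivity inside X.
      record Good (φ : Fin n → Set) (u : Fin n) : Set where
        field
          at-X   : T (X u) → φ u
          near-X : ∀ i → T (V i u) → ¬ T (X u) → ∃ λ x → T (X x) × Conn (Fof i) u x × φ x

      module Propagate (φ : Fin n → Set)
                       (closed : ∀ i x x' → T (X x) → T (X x') → Conn (Fof i) x x' → φ x' → φ x) where

        good-conn : ∀ i u u' → T (V i u) → T (V i u') → Conn (Fof i) u u' → Good φ u' → Good φ u
        good-conn i u u' vu vu' c g = record { at-X = at ; near-X = near }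
          where
          open Good g
          via-u' : ∃ λ x → T (X x) × Conn (Fof i) u x × φ x
          via-u' with T? (X u')
          ... | yes xu' = u' , xu' , c , at-X xu'
          ... | no nxu' = let (x , xx , c' , φx) = near-X i vu' nxu' in x , xx , conn-trans (Fof i) c c' , φx
          at : T (X u) → φ u
          at xu = let (x , xx , c' , φx) = via-u' in closed i u x xu xx c' φx
          near : ∀ j → T (V j u) → ¬ T (X u) → ∃ λ x → T (X x) × Conn (Fof j) u x × φ x
          near j vj nxu with same-side-or-X i j vu vj
          ... | inj₁ refl = via-u'
          ... | inj₂ xu   = ⊥-elim (nxu xu)

        good-walk : ∀ t u w → T (reach ends F t u w) → Good φ w → Good φ u
        good-walk zero u w p g = subst (Good φ) (sym (=F⁻ p)) g
        good-walk (suc t) u w p g with reach-step⁻ F t u w p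
        ... | inj₁ refl = g
        ... | inj₂ (d , u' , fd , jn , r) with edge-side fd jn
        ...   | i , fi , vu , vu' = good-conn i u u' vu vu' (conn-edge (Fof i) fi jn) (good-walk t u' w r g)

      ρ-least : (∀ i → T (Mᵢ i)) → ∀ π' → T (isLPart X π') → (∀ i → πᵢ i ⊑ π') → ρ ⊑ π'
      ρ-least ms π' iπ' ub = mk⊑ rel-part lab-part
        where
        open IsLP (toIsLP {Y = X} {π = π'} iπ')

        conn⇒rel : ∀ i a b → T (X a) → T (X b) → Conn (Fof i) a b → T (rel π' a b)
        conn⇒rel i a b xa xb c = ⊑-rel (ub i) a b (rel-cp⁺ (Fof i) (V i) (Kof i) X a b xa xb (X⇒V i xa) (X⇒V i xb) c)

        rel-part : ∀ x y → T (rel ρ x y) → T (rel π' x y)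
        rel-part x y r with rel-cp⁻ F allV K X x y r
        ... | xx , xy , _ , _ , c = Good.at-X (Propagate.good-walk φ closed n x y c g) xx
          where
          φ : Fin n → Set
          φ z = T (rel π' z y)
          closed : ∀ i a b → T (X a) → T (X b) → Conn (Fof i) a b → φ b → φ a
          closed i a b xa xb c φb = lp-trans a b y (conn⇒rel i a b xa xb c) φb
          g : Good φ y
          g = record { at-X = λ _ → lp-refl y xy ; near-X = λ _ _ nxy → ⊥-elim (nxy xy) }

        lab-part : ∀ x → T (lab ρ x) → T (lab π' x)
        lab-part x l with lab-cp⁻ F allV K X x l
        ... | xx , _ , w , kw , c = Good.at-X (Propagate.good-walk φ closed n x w c g) xx
          where
          φ : Fin n → Set
          φ z = T (lab π' z)
          closed : ∀ i a b → T (X a) → T (X b) → Conn (Fof i) a b → φ b → φ a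
          closed i a b xa xb c φb = subst T (sym (lp-labeq a b (conn⇒rel i a b xa xb c))) φb
          labelled : ∀ i z → T (X z) → T (V i w) → Conn (Fof i) z w → φ z
          labelled i z xz vw c = ⊑-lab (ub i) z (lab-cp⁺ (Fof i) (V i) (Kof i) X z w xz (X⇒V i xz) (∧⁺ {K w} kw vw) c)
          g : Good φ w
          g = record
            { at-X   = λ xw → labelled ₁ w xw (X⇒V ₁ xw) (conn-refl (Fof ₁) w)
            ; near-X = λ i vw nxw → let (z , xz , cz) = M⇒ReachesX i (Fof i) (ms i) w (∧⁺ {K w} kw vw) nxw in
                                    z , xz , cz , labelled i z xz vw (conn-sym (Fof i) cz)
            }

      ρ-join : (∀ i → T (Mᵢ i)) → ∀ π' → T (isLPart X π') → (ρ ≤L π') ≡ ((πᵢ ₁ ≤L π') ∧ (πᵢ ₂ ≤L π'))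
      ρ-join ms π' iπ' = T-ext
        (λ q → ∧⁺ {πᵢ ₁ ≤L π'} (unle (⊑-trans (π⊑ρ ₁) (le {σ = ρ} q))) (unle (⊑-trans (π⊑ρ ₂) (le {σ = ρ} q))))
        (λ q → unle (ρ-least ms π' iπ' (λ { ₁ → le (∧⁻ˡ {πᵢ ₁ ≤L π'} q) ; ₂ → le (∧⁻ʳ {πᵢ ₁ ≤L π'} q) })))

      K-to-labelled : (∀ i → T (Mᵢ i)) → ∀ u → T (K u) → ∃ λ x → T (lab ρ x) × Conn F u x
      K-to-labelled ms u ku = toX (vertUnion u)
        where
        from-side : ∀ i → T (V i u) → ∃ λ x → T (lab ρ x) × Conn F u x
        from-side i vu = let (x , xx , c) = K-reaches-X i (Fof i) (ms i) u (∧⁺ {K u} ku vu)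
                             cF = conn-sym F (conn-monoF (Fof i) F (Fof⊆F i) c)
                         in x , lab-cp⁺ F allV K X x u xx tt ku (conn-sym F cF) , cF
        toX : T (V1 u) ⊎ T (V2 u) → ∃ λ x → T (lab ρ x) × Conn F u x
        toX (inj₁ v1) = from-side ₁ v1
        toX (inj₂ v2) = from-side ₂ v2

      MF⇒one-block : T MF → numLabelledBlocks ρ ≡ 1
      MF⇒one-block mf = one-labelled-block⁺ ρ (toIsLP {Y = X} ρ-isLP) (anyF⁻ n (ρ-hasLB (MF⇒M ₁ mf))) related
        where
        related : ∀ x y → T (lab ρ x) → T (lab ρ y) → T (rel ρ x y)
        related x y lx ly =
          let (xx , _ , wx , kx , cx) = lab-cp⁻ F allV K X x lx
              (xy , _ , wy , ky , cy) = lab-cp⁻ F allV K X y ly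
          in rel-cp⁺ F allV K X x y xx xy tt tt (conn-trans F cx (conn-trans F (MF-conn mf wx wy kx ky) (conn-sym F cy)))

      one-block⇒MF : (∀ i → T (Mᵢ i)) → numLabelledBlocks ρ ≡ 1 → T MF
      one-block⇒MF ms one = allF⁺ n (λ u → allF⁺ n (λ v → ⇒⁺ (λ kk → connected u v (∧⁻ˡ {K u} kk) (∧⁻ʳ {K u} kk))))
        where
        connected : ∀ u v → T (K u) → T (K v) → Conn F u v
        connected u v ku kv =
          let (x , lx , cu) = K-to-labelled ms u ku
              (y , ly , cv) = K-to-labelled ms v kv
              (_ , _ , _ , _ , cxy) = rel-cp⁻ F allV K X x y (one-labelled-block⁻ ρ (toIsLP {Y = X} ρ-isLP) one x y lx ly)
          in conn-trans F cu (conn-trans F cxy (conn-sym F cv))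

-- When E₁ and E₂ partition the
-- edges, F ↦ (F ∩ E₁, F ∩ E₂) is a bijection, so a sum over all edge sets
-- F splits into a double sum over F₁ ⊆ E₁ and F₂ ⊆ E₂ of the value at
-- F₁ ∪ F₂.
module EdgeSubsets {c ℓ : Level} (Rg : CommutativeRing c ℓ) where

  open import Defs
  open RingSums Rg
  open import Data.Bool using (Bool; true; false; _∨_; T)
  open import Data.Unit using (tt)
  open import Data.Nat using (zero; suc)
  open import Data.Fin using (zero; suc)
  open import Data.List using (map)
  open import Data.Product using (_×_; _,_)
  open import Data.Sum using (_⊎_; inj₁; inj₂)
  open import Data.Empty using (⊥-elim)
  open import Relation.Nullary using (¬_)
  open import Relation.Binary.PropositionalEquality as P using (_≡_)
  open CommutativeRing Rg hiding (zero)
  open import Relation.Binary.Reasoning.Setoid setoid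

  sumSub : ∀ m → VSet m → (VSet m → Carrier) → Carrier
  sumSub m E g = sumL (λ F → ind (allF m (λ d → F d ⇒ᵇ E d)) * g F) (allSubsets m)

  sumSub-spanning : ∀ m E g → sumL g (spanning E) ≈ sumSub m E g
  sumSub-spanning m E g = sumL-filter g (λ F → allF m (λ d → F d ⇒ᵇ E d)) (allSubsets m)

  sumSub-cong : ∀ m E {g g' : VSet m → Carrier} → (∀ F → g F ≈ g' F) → sumSub m E g ≈ sumSub m E g'
  sumSub-cong m E e = sumL-cong (allSubsets m) (λ F → *-congˡ (e F))

  sumSub-+ : ∀ m E (f g : VSet m → Carrier) → sumSub m E (λ F → f F + g F) ≈ sumSub m E f + sumSub m E g
  sumSub-+ m E f g = trans (sumL-cong (allSubsets m) (λ F → distribˡ _ (f F) (g F))) (sumL-+ _ _ (allSubsets m))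

  sum-free : ∀ (G : Bool → Carrier) → sumL (λ a → ind (a ⇒ᵇ true) * G a) bools ≈ G true + G false
  sum-free G = +-cong (*-identityˡ _) (trans (+-identityʳ _) (*-identityˡ _))

  sum-forced : ∀ (G : Bool → Carrier) → sumL (λ a → ind (a ⇒ᵇ false) * G a) bools ≈ G false
  sum-forced G = trans (+-cong (zeroˡ _) (trans (+-identityʳ _) (*-identityˡ _))) (+-identityˡ _)

  sumSub-unfold : ∀ m E g → sumSub (suc m) E g
                ≈ sumL (λ a → ind (a ⇒ᵇ E zero) * sumSub m (λ d → E (suc d)) (λ F → g (consF a F))) bools
  sumSub-unfold m E g = begin
    sumSub (suc m) E g
      ≈⟨ sumL-concatMap (λ F → ind (allF (suc m) (λ d → F d ⇒ᵇ E d)) * g F) (λ a → map (consF a) (allSubsets m)) bools ⟩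
    sumL (λ a → sumL (λ F → ind (allF (suc m) (λ d → F d ⇒ᵇ E d)) * g F) (map (consF a) (allSubsets m))) bools
      ≈⟨ sumL-cong bools (λ a → trans (sumL-map (λ F → ind (allF (suc m) (λ d → F d ⇒ᵇ E d)) * g F) (consF a) (allSubsets m))
           (trans (sumL-cong (allSubsets m) (λ F → sym (ind-∧* (a ⇒ᵇ E zero) (rest F) (g (consF a F)))))
                  (sym (sumL-*ˡ (ind (a ⇒ᵇ E zero)) (λ F → ind (rest F) * g (consF a F)) (allSubsets m))))) ⟩
    sumL (λ a → ind (a ⇒ᵇ E zero) * sumSub m (λ d → E (suc d)) (λ F → g (consF a F))) bools ∎
    where
    rest : VSet m → Bool
    rest F = allF m (λ d → F d ⇒ᵇ E (suc d))

  sumSub-split : ∀ m (E1 E2 : VSet m) → (∀ d → T (E1 d) ⊎ T (E2 d)) → (∀ d → ¬ (T (E1 d) × T (E2 d)))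
    → ∀ (h : VSet m → Carrier) → (∀ F F' → (∀ d → F d ≡ F' d) → h F ≈ h F')
    → sumSub m (λ _ → true) h ≈ sumSub m E1 (λ F1 → sumSub m E2 (λ F2 → h (λ d → F1 d ∨ F2 d)))
  sumSub-split zero E1 E2 cover disjoint h h-ext =
    +-congʳ (*-congˡ (trans (h-ext _ _ (λ ())) (sym (trans (+-identityʳ _) (*-identityˡ _)))))
  sumSub-split (suc m) E1 E2 cover disjoint h h-ext = begin
    sumSub (suc m) (λ _ → true) h
      ≈⟨ sumSub-unfold m (λ _ → true) h ⟩
    sumL (λ a → ind (a ⇒ᵇ true) * sumSub m (λ _ → true) (λ F → h (consF a F))) bools
      ≈⟨ sumL-cong bools (λ a → *-congˡ {ind (a ⇒ᵇ true)} (sumSub-split m E1' E2' (λ d → cover (suc d)) (λ d → disjoint (suc d))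
                                            (λ F → h (consF a F)) (λ F F' e → h-ext _ _ (consF-cong a e)))) ⟩
    sumL (λ a → ind (a ⇒ᵇ true) * sumSub m E1' (λ F1 → sumSub m E2' (λ F2 → H′ a F1 F2))) bools
      ≈⟨ sym (first-coordinate (E1 zero) (E2 zero) (cover zero) (disjoint zero)) ⟩
    sumL (λ a1 → ind (a1 ⇒ᵇ E1 zero) * sumSub m E1' (λ F1 →
      sumL (λ a2 → ind (a2 ⇒ᵇ E2 zero) * sumSub m E2' (λ F2 → H a1 a2 F1 F2)) bools)) bools
      ≈⟨ sumL-cong bools (λ a1 → *-congˡ {ind (a1 ⇒ᵇ E1 zero)} (sumSub-cong m E1' (λ F1 →
           sym (sumSub-unfold m E2 (λ F2 → h (λ d → consF a1 F1 d ∨ F2 d)))))) ⟩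
    sumL (λ a1 → ind (a1 ⇒ᵇ E1 zero) * sumSub m E1' (λ F1 → sumSub (suc m) E2 (λ F2 → h (λ d → consF a1 F1 d ∨ F2 d)))) bools
      ≈⟨ sym (sumSub-unfold m E1 (λ F1 → sumSub (suc m) E2 (λ F2 → h (λ d → F1 d ∨ F2 d)))) ⟩
    sumSub (suc m) E1 (λ F1 → sumSub (suc m) E2 (λ F2 → h (λ d → F1 d ∨ F2 d))) ∎
    where
    E1' E2' : VSet m
    E1' d = E1 (suc d)
    E2' d = E2 (suc d)
    consF-cong : ∀ a {F F' : VSet m} → (∀ d → F d ≡ F' d) → ∀ d → consF a F d ≡ consF a F' d
    consF-cong a e zero    = P.refl
    consF-cong a e (suc d) = e d
    H : Bool → Bool → VSet m → VSet m → Carrier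
    H a1 a2 F1 F2 = h (λ d → consF a1 F1 d ∨ consF a2 F2 d)
    H′ : Bool → VSet m → VSet m → Carrier
    H′ a F1 F2 = h (consF a (λ d → F1 d ∨ F2 d))
    H≈H′ : ∀ a1 a2 F1 F2 → H a1 a2 F1 F2 ≈ H′ (a1 ∨ a2) F1 F2
    H≈H′ a1 a2 F1 F2 = h-ext _ _ (λ { zero → P.refl ; (suc d) → P.refl })
    ∨false : ∀ a → (a ∨ false) ≡ a
    ∨false true  = P.refl
    ∨false false = P.refl
    -- The first edge lies in exactly one of E1, E2; the coordinate of the
    -- other side is forced to be false.
    first-coordinate : ∀ b1 b2 → T b1 ⊎ T b2 → ¬ (T b1 × T b2) →
        sumL (λ a1 → ind (a1 ⇒ᵇ b1) * sumSub m E1' (λ F1 →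
          sumL (λ a2 → ind (a2 ⇒ᵇ b2) * sumSub m E2' (λ F2 → H a1 a2 F1 F2)) bools)) bools
      ≈ sumL (λ a → ind (a ⇒ᵇ true) * sumSub m E1' (λ F1 → sumSub m E2' (λ F2 → H′ a F1 F2))) bools
    first-coordinate true  true  _ both = ⊥-elim (both (tt , tt))
    first-coordinate false false (inj₁ ()) _
    first-coordinate false false (inj₂ ()) _
    first-coordinate true  false _ _ = sumL-cong bools (λ a1 → *-congˡ {ind (a1 ⇒ᵇ true)} (sumSub-cong m E1' (λ F1 → begin
      sumL (λ a2 → ind (a2 ⇒ᵇ false) * sumSub m E2' (λ F2 → H a1 a2 F1 F2)) bools ≈⟨ sum-forced (λ a2 → sumSub m E2' (λ F2 → H a1 a2 F1 F2)) ⟩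
      sumSub m E2' (λ F2 → H a1 false F1 F2)
        ≈⟨ sumSub-cong m E2' (λ F2 → trans (H≈H′ a1 false F1 F2) (≡⇒≈ (P.cong (λ a → H′ a F1 F2) (∨false a1)))) ⟩
      sumSub m E2' (λ F2 → H′ a1 F1 F2) ∎)))
    first-coordinate false true _ _ = begin
      sumL (λ a1 → ind (a1 ⇒ᵇ false) * sumSub m E1' (λ F1 →
        sumL (λ a2 → ind (a2 ⇒ᵇ true) * sumSub m E2' (λ F2 → H a1 a2 F1 F2)) bools)) bools
        ≈⟨ sum-forced (λ a1 → sumSub m E1' (λ F1 → sumL (λ a2 → ind (a2 ⇒ᵇ true) * sumSub m E2' (λ F2 → H a1 a2 F1 F2)) bools)) ⟩
      sumSub m E1' (λ F1 → sumL (λ a2 → ind (a2 ⇒ᵇ true) * sumSub m E2' (λ F2 → H false a2 F1 F2)) bools)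
        ≈⟨ sumSub-cong m E1' (λ F1 → sum-free (λ a2 → sumSub m E2' (λ F2 → H false a2 F1 F2))) ⟩
      sumSub m E1' (λ F1 → sumSub m E2' (λ F2 → H false true F1 F2) + sumSub m E2' (λ F2 → H false false F1 F2))
        ≈⟨ sumSub-+ m E1' _ _ ⟩
      sumSub m E1' (λ F1 → sumSub m E2' (λ F2 → H false true F1 F2)) + sumSub m E1' (λ F1 → sumSub m E2' (λ F2 → H false false F1 F2))
        ≈⟨ +-cong (sumSub-cong m E1' (λ F1 → sumSub-cong m E2' (λ F2 → H≈H′ false true F1 F2)))
                  (sumSub-cong m E1' (λ F1 → sumSub-cong m E2' (λ F2 → H≈H′ false false F1 F2))) ⟩
      sumSub m E1' (λ F1 → sumSub m E2' (λ F2 → H′ true F1 F2)) + sumSub m E1' (λ F1 → sumSub m E2' (λ F2 → H′ false F1 F2))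
        ≈⟨ sym (sum-free (λ a → sumSub m E1' (λ F1 → sumSub m E2' (λ F2 → H′ a F1 F2)))) ⟩
      sumL (λ a → ind (a ⇒ᵇ true) * sumSub m E1' (λ F1 → sumSub m E2' (λ F2 → H′ a F1 F2))) bools ∎

module FormulaSides {c ℓ : Level} (Rg : CommutativeRing c ℓ) (G : Multigraph)
            (p : Fin (Multigraph.m G) → CommutativeRing.Carrier Rg)
            (K V1 V2 : VSet (Multigraph.n G)) (E1 E2 : VSet (Multigraph.m G))
            (S : IsKSplitting G K V1 V2 E1 E2) where

  open BoolReflection
  open PartitionOrder
  open FilteredLists
  open Walks
  open Splitting
  open import Data.Integer.Properties using (+-*-commutativeRing)
  import Data.Integer.Properties as ℤP
  open import Data.Bool using (Bool; true; false; _∧_; _∨_; if_then_else_; T)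
  open import Data.Bool.Properties using (T?)
  open import Data.Unit using (tt; ⊤)
  open import Data.Nat using (zero; suc)
  open import Data.Integer as ℤ using (ℤ; +_; -[1+_])
  open import Data.Fin using (zero; suc)
  open import Data.List.Membership.Propositional using (_∈_)
  open import Data.Product using (_×_; _,_; proj₁; proj₂)
  open import Data.Sum using (_⊎_; inj₁; inj₂)
  open import Data.Empty using (⊥; ⊥-elim)
  open import Relation.Nullary using (¬_; yes; no)
  open import Relation.Binary.PropositionalEquality as P using (_≡_)

  open Multigraph G
  open IsKSplitting S
  open RingSums Rg
  open Enumeration Rg
  open EdgeSubsets Rg
  open CommutativeRing Rg hiding (zero)
  open import Relation.Binary.Reasoning.Setoid setoid
  open import Algebra.Solver.CommutativeMonoid *-commutativeMonoid using (solve; _⊜_; _⊕_)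
  open Split G p K V1 V2 E1 E2
  open KSplitting G K V1 V2 E1 E2 S using (Side; ₁; ₂; V; E; M; π; π-isLP; πX⊑π; π-hasLB; module Joined)

  qX : LPart n → Bool
  qX π = (πX ≤L π) ∧ hasLabelledBlock π

  qX-resp : ∀ a b → a ≐ b → qX a ≡ qX b
  qX-resp a b e = P.cong₂ _∧_ (≤L-respʳ {a = πX} e) (hasLB-resp e)

  qX-up : ∀ {a b} → a ⊑ b → T (qX a) → T (qX b)
  qX-up {a} {b} ab q = ∧⁺ {πX ≤L b} (unle (⊑-trans (le {σ = πX} {π = a} (∧⁻ˡ {πX ≤L a} q)) ab)) (hasLB-mono ab (∧⁻ʳ {πX ≤L a} q))

  ΠX⇒isLPart : ∀ {π} → π ∈ ΠX → T (isLPart X π)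
  ΠX⇒isLPart mπ = ∈ΠL⇒isLPart {Y = X} (proj₁ (∈-filterB⁻ {p = qX} (ΠL X) mπ))

  sifts-ΠX : SiftsL ΠX (λ π → (⊤ × T (isLPart X π)) × T (qX π))
  sifts-ΠX = siftsL-filter (ΠL X) _ qX (sifts-ΠL X) qX-resp

  ΣΣ : (VSet m → VSet m → Carrier) → Carrier
  ΣΣ f = sumL (λ F1 → sumL (λ F2 → f F1 F2) (spanning E2)) (spanning E1)

  ΣΣ-cong : ∀ {f g : VSet m → VSet m → Carrier}
          → (∀ F1 F2 → F1 ∈ spanning E1 → F2 ∈ spanning E2 → f F1 F2 ≈ g F1 F2) → ΣΣ f ≈ ΣΣ g
  ΣΣ-cong e = sumL-cong∈ (spanning E1) (λ F1 m1 → sumL-cong∈ (spanning E2) (λ F2 m2 → e F1 F2 m1 m2))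

  _∪_ : VSet m → VSet m → VSet m
  (F1 ∪ F2) d = F1 d ∨ F2 d

  fλ : LPart n → Carrier
  fλ π = fromℤ (λL π)

  λ-inversion : ∀ ρ → T (isLPart X ρ) → T (qX ρ) → sumL (λ π → ind (ρ ≤L π) * fλ π) ΠX ≈ fromℤ (mL ρ)
  λ-inversion ρ iρ qρ = begin
    sumL (λ π → ind (ρ ≤L π) * fλ π) ΠX                  ≈⟨ sumL-cong ΠX (λ π → sym (fromℤ-ind (ρ ≤L π) (λL π))) ⟩
    sumL (λ π → fromℤ (if ρ ≤L π then λL π else + 0)) ΠX  ≈⟨ sym (fromℤ-sum (λ π → if ρ ≤L π then λL π else + 0) ΠX) ⟩
    fromℤ (sumℤ (λ π → if ρ ≤L π then λL π else + 0) ΠX) ≡⟨ P.cong fromℤ in-ℤ ⟩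
    fromℤ (mL ρ)                                          ∎
    where
    module ℤR = RingSums +-*-commutativeRing
    module Mob = Mobius.Mob (ΠL X) (λ π → ⊤ × T (isLPart X π)) (Enumeration.sifts-ΠL +-*-commutativeRing X)
                            (λ x mx → tt , ∈ΠL⇒isLPart {Y = X} mx)
    module Inv = Mob.Inversion qX qX-resp qX-up
    if-as-ind : ∀ b z → (if b then z else + 0) ≡ ℤR.ind b ℤ.* z
    if-as-ind true  z = P.sym (ℤP.*-identityˡ z)
    if-as-ind false z = P.sym (ℤP.*-zeroˡ z)
    in-ℤ : sumℤ (λ π → if ρ ≤L π then λL π else + 0) ΠX ≡ mL ρ
    in-ℤ = P.trans (Mobius.sumℤ≡sumL _ ΠX)
             (P.trans (ℤR.sumL-cong ΠX (λ π → if-as-ind (ρ ≤L π) (λL π))) (Inv.inversion ρ (tt , iρ) qρ))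

  -- the entry π of Zᵀ p(Gⁱ): Σ_{σ ≤ π} P(Gⁱ, σ)
  ζP : Side → LPart n → Carrier
  ζP i π = sumL (λ σ → ind (σ ≤L π) * Pfun (V i) (E i) σ) ΠX

  allPos-sum : ∀ k (g : Fin k → Carrier) → sumL g (allPos k) ≈ sumFin k g
  allPos-sum zero    g = refl
  allPos-sum (suc k) g = +-congˡ (trans (sumL-map g suc (allPos k)) (allPos-sum k (λ j → g (suc j))))

  sum-pos0 : ∀ (f : Fin N → Carrier) → sumFin N0 (λ i → f (sel i)) ≈ sumFin N (λ j → ind (nz (λL (idx j))) * f j)
  sum-pos0 f = trans (sumFin-lookup f pos0) (trans (sumL-filter f (λ j → nz (λL (idx j))) (allPos N)) (allPos-sum N _))

  nz-false : ∀ z → ¬ T (nz z) → fromℤ z ≈ 0#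
  nz-false (+ zero)  _ = refl
  nz-false (+ suc k) f = ⊥-elim (f tt)
  nz-false -[1+ k ]  f = ⊥-elim (f tt)

  drop-zero-λ : ∀ s (y : Carrier) → ind (nz (λL (idx s))) * (fλ (idx s) * y) ≈ fλ (idx s) * y
  drop-zero-λ s y with T? (nz (λL (idx s)))
  ... | yes q = ind-T* _ q
  ... | no q  = trans (ind-F* _ q) (sym (trans (*-congʳ (nz-false (λL (idx s)) q)) (zeroˡ _)))

  rhs-as-sum : rhs ≈ sumL (λ π → ζP ₁ π * (fλ π * ζP ₂ π)) ΠX
  rhs-as-sum = begin
    rhs                                                      ≈⟨ sumFin-cong N0 (λ i → *-congˡ (diagonal (sel i))) ⟩
    sumFin N0 (λ i → g (sel i))                              ≈⟨ sum-pos0 g ⟩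
    sumFin N (λ s → ind (nz (λL (idx s))) * g s)             ≈⟨ sumFin-cong N drop-indicators ⟩
    sumFin N (λ s → a ₁ s * (fλ (idx s) * a ₂ s))            ≈⟨ sumFin-cong N (λ s → *-cong (entry ₁ s) (*-congˡ (entry ₂ s))) ⟩
    sumFin N (λ s → ζP ₁ (idx s) * (fλ (idx s) * ζP ₂ (idx s))) ≈⟨ sumFin-lookup (λ π → ζP ₁ π * (fλ π * ζP ₂ π)) ΠX ⟩
    sumL (λ π → ζP ₁ π * (fλ π * ζP ₂ π)) ΠX                 ∎
    where
    a : Side → Fin N → Carrier
    a i = matVec (transpose Z) (pvec (V i) (E i))
    entry : ∀ i s → a i s ≈ ζP i (idx s)
    entry i s = sumFin-lookup (λ σ → ind (σ ≤L idx s) * Pfun (V i) (E i) σ) ΠX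
    g : Fin N → Carrier
    g s = a ₁ s * (ind (nz (λL (idx s))) * (fλ (idx s) * a ₂ s))
    drop-indicators : ∀ s → ind (nz (λL (idx s))) * g s ≈ a ₁ s * (fλ (idx s) * a ₂ s)
    drop-indicators s = trans (*-swapˡ (ind (nz (λL (idx s)))) (a ₁ s) _)
      (*-congˡ (trans (*-congˡ (drop-zero-λ s (a ₂ s))) (drop-zero-λ s (a ₂ s))))
    -- Λ₀ is diagonal: only the entry j = s survives
    diagonal : ∀ s → sumFin N0 (λ j → Λ s (sel j) * a ₂ (sel j)) ≈ ind (nz (λL (idx s))) * (fλ (idx s) * a ₂ s)
    diagonal s = trans (sum-pos0 (λ j → Λ s j * a ₂ j))
                       (trans (sumFin-cong N Λ-entry)
                              (sumFin-δ N (λ j → ind (nz (λL (idx j))) * (fλ (idx j) * a ₂ j)) s))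
      where
      Λ-entry : ∀ j → ind (nz (λL (idx j))) * (Λ s j * a ₂ j) ≈ ind (s =F= j) * (ind (nz (λL (idx j))) * (fλ (idx j) * a ₂ j))
      Λ-entry j with T? (s =F= j)
      ... | yes q with =F⁻ q
      ...   | P.refl = trans (*-congˡ (*-congʳ (≡⇒≈ (if-true {b = s =F= s} q)))) (sym (ind-T* _ q))
      Λ-entry j | no q = trans (*-congˡ (trans (*-congʳ (≡⇒≈ (if-false {b = s =F= j} q))) (zeroˡ _)))
                               (trans (zeroʳ _) (sym (ind-F* _ q)))

  w : Side → VSet m → Carrier
  w i F = ind (M i F) * Pr p (E i) F

  spanning⊆ : ∀ Ei F → F ∈ spanning Ei → ∀ d → T (F d) → T (Ei d)
  spanning⊆ Ei F mF d fd =
    ⇒⁻ {F d} (allF⁻ m {λ d → F d ⇒ᵇ Ei d} (proj₂ (∈-filterB⁻ {p = λ F' → allF m (λ d → F' d ⇒ᵇ Ei d)} (allSubsets m) mF)) d) fd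

  π∈ΠX : ∀ i F → T (M i F) → (⊤ × T (isLPart X (π i F))) × T (qX (π i F))
  π∈ΠX i F mi = (tt , π-isLP i F) , ∧⁺ {πX ≤L π i F} (unle (πX⊑π i F)) (π-hasLB i F mi)

  ζP-expansion : ∀ i σ → ζP i σ ≈ sumL (λ F → w i F * ind (π i F ≤L σ)) (spanning (E i))
  ζP-expansion i σ = begin
    ζP i σ
      ≈⟨ sumL-cong ΠX (λ τ → sumL-*ˡ (ind (τ ≤L σ)) (λ F → (ind (π i F =L= τ) * ind (M i F)) * Pr p (E i) F) (spanning (E i))) ⟩
    sumL (λ τ → sumL (λ F → ind (τ ≤L σ) * ((ind (π i F =L= τ) * ind (M i F)) * Pr p (E i) F)) (spanning (E i))) ΠX
      ≈⟨ sumL-swap _ ΠX (spanning (E i)) ⟩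
    sumL (λ F → sumL (λ τ → ind (τ ≤L σ) * ((ind (π i F =L= τ) * ind (M i F)) * Pr p (E i) F)) ΠX) (spanning (E i))
      ≈⟨ sumL-cong (spanning (E i)) (λ F → sumL-cong ΠX (λ τ → regroup (ind (τ ≤L σ)) (ind (π i F =L= τ)) (ind (M i F)) (Pr p (E i) F))) ⟩
    sumL (λ F → sumL (λ τ → ind (π i F =L= τ) * (w i F * ind (τ ≤L σ))) ΠX) (spanning (E i))
      ≈⟨ sumL-cong (spanning (E i)) sift ⟩
    sumL (λ F → w i F * ind (π i F ≤L σ)) (spanning (E i)) ∎
    where
    regroup : ∀ x y z u → x * ((y * z) * u) ≈ y * ((z * u) * x)
    regroup = solve 4 (λ x y z u → x ⊕ ((y ⊕ z) ⊕ u) ⊜ y ⊕ ((z ⊕ u) ⊕ x)) refl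
    sift : ∀ F → sumL (λ τ → ind (π i F =L= τ) * (w i F * ind (τ ≤L σ))) ΠX ≈ w i F * ind (π i F ≤L σ)
    sift F with T? (M i F)
    ... | yes mi = sifts-ΠX (λ τ → w i F * ind (τ ≤L σ)) (λ x y e → *-congˡ (ind-≡ (≤L-respˡ {b = σ} e))) (π i F) (π∈ΠX i F mi)
    ... | no nmi = trans (sumL-0 ΠX (λ τ → trans (*-congˡ (trans (*-congʳ w≈0) (zeroˡ _))) (zeroʳ _)))
                         (sym (trans (*-congʳ w≈0) (zeroˡ _)))
      where w≈0 : w i F ≈ 0#
            w≈0 = ind-F* (Pr p (E i) F) nmi

  rhs-inner : VSet m → VSet m → Carrier
  rhs-inner F1 F2 = (w ₁ F1 * w ₂ F2) * sumL (λ π' → ind (π ₁ F1 ≤L π') * (ind (π ₂ F2 ≤L π') * fλ π')) ΠX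

  rhs-expanded : sumL (λ π' → ζP ₁ π' * (fλ π' * ζP ₂ π')) ΠX ≈ ΣΣ rhs-inner
  rhs-expanded = begin
    sumL (λ π' → ζP ₁ π' * (fλ π' * ζP ₂ π')) ΠX
      ≈⟨ sumL-cong ΠX (λ π' → *-cong (ζP-expansion ₁ π') (*-congˡ (ζP-expansion ₂ π'))) ⟩
    sumL (λ π' → sumL (λ F1 → a F1 π') (spanning E1) * (fλ π' * sumL (λ F2 → b F2 π') (spanning E2))) ΠX
      ≈⟨ sumL-cong ΠX (λ π' → trans (sumL-*ʳ _ (λ F1 → a F1 π') (spanning E1))
           (sumL-cong (spanning E1) (λ F1 → trans (*-congˡ (sumL-*ˡ (fλ π') (λ F2 → b F2 π') (spanning E2)))
             (trans (sumL-*ˡ (a F1 π') _ (spanning E2)) (sumL-cong (spanning E2) (λ F2 → regroup F1 F2 π')))))) ⟩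
    sumL (λ π' → sumL (λ F1 → sumL (λ F2 → t F1 F2 π') (spanning E2)) (spanning E1)) ΠX
      ≈⟨ sumL-swap _ ΠX (spanning E1) ⟩
    sumL (λ F1 → sumL (λ π' → sumL (λ F2 → t F1 F2 π') (spanning E2)) ΠX) (spanning E1)
      ≈⟨ sumL-cong (spanning E1) (λ F1 → sumL-swap _ ΠX (spanning E2)) ⟩
    sumL (λ F1 → sumL (λ F2 → sumL (λ π' → t F1 F2 π') ΠX) (spanning E2)) (spanning E1)
      ≈⟨ sumL-cong (spanning E1) (λ F1 → sumL-cong (spanning E2) (λ F2 → sym (sumL-*ˡ (w ₁ F1 * w ₂ F2) _ ΠX))) ⟩
    ΣΣ rhs-inner ∎
    where
    a b : VSet m → LPart n → Carrier
    a F1 π' = w ₁ F1 * ind (π ₁ F1 ≤L π')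
    b F2 π' = w ₂ F2 * ind (π ₂ F2 ≤L π')
    t : VSet m → VSet m → LPart n → Carrier
    t F1 F2 π' = (w ₁ F1 * w ₂ F2) * (ind (π ₁ F1 ≤L π') * (ind (π ₂ F2 ≤L π') * fλ π'))
    regroup : ∀ F1 F2 π' → a F1 π' * (fλ π' * b F2 π') ≈ t F1 F2 π'
    regroup F1 F2 π' = solve 5 (λ a₁ i₁ a₂ i₂ l → (a₁ ⊕ i₁) ⊕ (l ⊕ (a₂ ⊕ i₂)) ⊜ (a₁ ⊕ a₂) ⊕ (i₁ ⊕ (i₂ ⊕ l))) refl
                         (w ₁ F1) (ind (π ₁ F1 ≤L π')) (w ₂ F2) (ind (π ₂ F2 ≤L π')) (fλ π')

  ρ : VSet m → VSet m → LPart n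
  ρ F1 F2 = compPart ends (F1 ∪ F2) (λ _ → true) K ⊓ X

  term : VSet m → VSet m → Carrier
  term F1 F2 = ((ind (M ₁ F1) * ind (M ₂ F2)) * fromℤ (mL (ρ F1 F2))) * (Pr p E1 F1 * Pr p E2 F2)

  -- With both M(Hᵢ_X): Σ_π [π₁ ≤ π][π₂ ≤ π] λ(π) = Σ_{π ≥ π₁ ∨ π₂} λ(π) = m(ρ).
  rhs-summand : ∀ F1 F2 → F1 ∈ spanning E1 → F2 ∈ spanning E2 → rhs-inner F1 F2 ≈ term F1 F2
  rhs-summand F1 F2 mF1 mF2 with T? (M ₁ F1) | T? (M ₂ F2)
  ... | yes m₁ | yes m₂ = begin
      (w ₁ F1 * w ₂ F2) * sumL (λ π' → ind (π ₁ F1 ≤L π') * (ind (π ₂ F2 ≤L π') * fλ π')) ΠX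
        ≈⟨ *-congˡ (sumL-cong∈ ΠX (λ π' mπ → trans (ind-∧* (π ₁ F1 ≤L π') (π ₂ F2 ≤L π') (fλ π'))
                                              (*-congʳ (ind-≡ (P.sym (J.ρ-join ms π' (ΠX⇒isLPart mπ))))))) ⟩
      (w ₁ F1 * w ₂ F2) * sumL (λ π' → ind (ρ F1 F2 ≤L π') * fλ π') ΠX
        ≈⟨ *-congˡ (λ-inversion (ρ F1 F2) J.ρ-isLP (∧⁺ {πX ≤L ρ F1 F2} (unle J.πX⊑ρ) (J.ρ-hasLB m₁))) ⟩
      (w ₁ F1 * w ₂ F2) * fromℤ (mL (ρ F1 F2))
        ≈⟨ regroup (ind (M ₁ F1)) (Pr p E1 F1) (ind (M ₂ F2)) (Pr p E2 F2) (fromℤ (mL (ρ F1 F2))) ⟩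
      term F1 F2 ∎
    where
    module J = Joined F1 F2 (spanning⊆ E1 F1 mF1) (spanning⊆ E2 F2 mF2)
    ms : ∀ i → T (J.Mᵢ i)
    ms ₁ = m₁
    ms ₂ = m₂
    regroup : ∀ a b x y f → ((a * b) * (x * y)) * f ≈ ((a * x) * f) * (b * y)
    regroup = solve 5 (λ a b x y f → ((a ⊕ b) ⊕ (x ⊕ y)) ⊕ f ⊜ ((a ⊕ x) ⊕ f) ⊕ (b ⊕ y)) refl
  ... | no n₁ | _ = trans (zero-factorˡ (zero-factorˡ (ind-F* (Pr p E1 F1) n₁)))
                            (sym (zero-factorˡ (zero-factorˡ (zero-factorˡ (ind-F n₁)))))
  ... | yes _ | no n₂ = trans (zero-factorˡ (zero-factorʳ (ind-F* (Pr p E2 F2) n₂)))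
                              (sym (zero-factorˡ (zero-factorˡ (zero-factorʳ (ind-F n₂)))))

  hR : VSet m → Carrier
  hR F = ind (Mconn ends F K) * Pr p (allE G p) F

  hR-ext : ∀ F F' → (∀ d → F d ≡ F' d) → hR F ≈ hR F'
  hR-ext F F' e = *-cong (ind-≡ (allF-cong n (λ u → allF-cong n (λ v →
                            P.cong ((K u ∧ K v) ⇒ᵇ_) (Walk.conn-ext ends F F' e u v)))))
                         (prodFin-cong m (λ d → ≡⇒≈ (P.cong (λ b → if b then p d else 1# + - p d) (e d))))

  R-as-double-sum : Rel G p K ≈ ΣΣ (λ F1 F2 → hR (F1 ∪ F2))
  R-as-double-sum = begin
    Rel G p K                                                   ≈⟨ sumSub-spanning m (allE G p) hR ⟩
    sumSub m (λ _ → true) hR                                    ≈⟨ sumSub-split m E1 E2 edgeUnion edgeDisj hR hR-ext ⟩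
    sumSub m E1 (λ F1 → sumSub m E2 (λ F2 → hR (F1 ∪ F2)))
      ≈⟨ sumSub-cong m E1 (λ F1 → sym (sumSub-spanning m E2 (λ F2 → hR (F1 ∪ F2)))) ⟩
    sumSub m E1 (λ F1 → sumL (λ F2 → hR (F1 ∪ F2)) (spanning E2))
      ≈⟨ sym (sumSub-spanning m E1 (λ F1 → sumL (λ F2 → hR (F1 ∪ F2)) (spanning E2))) ⟩
    ΣΣ (λ F1 F2 → hR (F1 ∪ F2)) ∎

  -- Pr factorises over the two sides: every edge lies in exactly one Eᵢ.
  Pr-split : ∀ F1 F2 → (∀ d → T (F1 d) → T (E1 d)) → (∀ d → T (F2 d) → T (E2 d))
           → Pr p (allE G p) (F1 ∪ F2) ≈ Pr p E1 F1 * Pr p E2 F2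
  Pr-split F1 F2 h1 h2 = trans (prodFin-cong m factor) (prodFin-* m f1 f2)
    where
    f1 f2 : Fin m → Carrier
    f1 d = if E1 d then (if F1 d then p d else 1# + - p d) else 1#
    f2 d = if E2 d then (if F2 d then p d else 1# + - p d) else 1#
    factor : ∀ d → (if (F1 d ∨ F2 d) then p d else 1# + - p d) ≈ f1 d * f2 d
    factor d with E1 d in e1 | E2 d in e2
    ... | true  | true  = ⊥-elim (edgeDisj d (P.subst T (P.sym e1) tt , P.subst T (P.sym e2) tt))
    ... | false | false = ⊥-elim (neither (edgeUnion d))
      where neither : T (E1 d) ⊎ T (E2 d) → ⊥
            neither (inj₁ x) = P.subst T e1 x
            neither (inj₂ x) = P.subst T e2 x
    ... | true  | false with F1 d | F2 d in r2
    ...   | _     | true  = ⊥-elim (P.subst T e2 (h2 d (P.subst T (P.sym r2) tt)))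
    ...   | true  | false = sym (*-identityʳ _)
    ...   | false | false = sym (*-identityʳ _)
    factor d | false | true with F1 d in r1 | F2 d
    ...   | true  | _     = ⊥-elim (P.subst T e1 (h1 d (P.subst T (P.sym r1) tt)))
    ...   | false | true  = sym (*-identityˡ _)
    ...   | false | false = sym (*-identityˡ _)

  M-factorises : ∀ F1 F2 (h1 : ∀ d → T (F1 d) → T (E1 d)) (h2 : ∀ d → T (F2 d) → T (E2 d))
               → ind (Mconn ends (F1 ∪ F2) K) ≈ (ind (M ₁ F1) * ind (M ₂ F2)) * fromℤ (mL (ρ F1 F2))
  M-factorises F1 F2 h1 h2 with T? (Mconn ends (F1 ∪ F2) K)
  ... | yes mf = begin
    ind (Mconn ends (F1 ∪ F2) K)                        ≈⟨ ind-T mf ⟩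
    1#                                                  ≈⟨ sym (trans (*-identityʳ _) (*-identityˡ 1#)) ⟩
    (1# * 1#) * 1#                                      ≈⟨ sym (*-cong (*-cong (ind-T (J.MF⇒M ₁ mf)) (ind-T (J.MF⇒M ₂ mf)))
                                                                       (mL-one (ρ F1 F2) (J.MF⇒one-block mf))) ⟩
    (ind (M ₁ F1) * ind (M ₂ F2)) * fromℤ (mL (ρ F1 F2)) ∎
    where module J = Joined F1 F2 h1 h2
  ... | no nmf with T? (M ₁ F1) | T? (M ₂ F2)
  ...   | no n₁ | _     = trans (ind-F nmf) (sym (zero-factorˡ (zero-factorˡ (ind-F n₁))))
  ...   | yes _ | no n₂ = trans (ind-F nmf) (sym (zero-factorˡ (zero-factorʳ (ind-F n₂))))
  ...   | yes m₁ | yes m₂ = trans (ind-F nmf) (sym (zero-factorʳ (mL-other (ρ F1 F2) (λ one → nmf (J.one-block⇒MF ms one)))))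
    where
    module J = Joined F1 F2 h1 h2
    ms : ∀ i → T (J.Mᵢ i)
    ms ₁ = m₁
    ms ₂ = m₂

  lhs-summand : ∀ F1 F2 → F1 ∈ spanning E1 → F2 ∈ spanning E2 → hR (F1 ∪ F2) ≈ term F1 F2
  lhs-summand F1 F2 mF1 mF2 = *-cong (M-factorises F1 F2 h1 h2) (Pr-split F1 F2 h1 h2)
    where h1 = spanning⊆ E1 F1 mF1
          h2 = spanning⊆ E2 F2 mF2

-- Both sides equal Σ_{F₁ ⊆ E₁} Σ_{F₂ ⊆ E₂} term F₁ F₂.
lemma7p1 : {c ℓ : Level} (Rg : CommutativeRing c ℓ) (G : Multigraph)
    (p : Fin (Multigraph.m G) → CommutativeRing.Carrier Rg)
    (K : VSet (Multigraph.n G)) → 2 ≤ countF (Multigraph.n G) K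
    → (V1 V2 : VSet (Multigraph.n G)) (E1 E2 : VSet (Multigraph.m G))
    → IsKSplitting G K V1 V2 E1 E2
    → CommutativeRing._≈_ Rg (WithRing.Rel Rg G p K)
        (WithRing.Split.rhs Rg G p K V1 V2 E1 E2)
lemma7p1 Rg G p K _ V1 V2 E1 E2 S = begin
  Rel G p K                                  ≈⟨ R-as-double-sum ⟩
  ΣΣ (λ F1 F2 → hR (F1 ∪ F2))                ≈⟨ ΣΣ-cong lhs-summand ⟩
  ΣΣ term                                    ≈⟨ sym (ΣΣ-cong rhs-summand) ⟩
  ΣΣ rhs-inner                               ≈⟨ sym rhs-expanded ⟩
  sumL (λ π → ζP ₁ π * (fλ π * ζP ₂ π)) ΠX   ≈⟨ sym rhs-as-sum ⟩
  rhs                                        ∎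
  where
  open FormulaSides Rg G p K V1 V2 E1 E2 S
  open WithRing Rg using (Rel; sumL)
  open WithRing.Split Rg G p K V1 V2 E1 E2 using (rhs; ΠX)
  open Splitting.KSplitting G K V1 V2 E1 E2 S using (₁; ₂)
  open CommutativeRing Rg using (sym; _*_)
  open import Relation.Binary.Reasoning.Setoid (CommutativeRing.setoid Rg)
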